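{- Let $L$ be a finite field of order $q$. The exponent $s=q-2$ is nice over $L$ if and only if $q\not\equiv 1\pmod 6$. Moreover, the differential multiplicities $N(1,v)$, $v\in L$, are as follows: if $q\equiv 2\pmod 6$, the value $0$ occurs $q/2$ times and the value $2$ occurs $q/2$ times; if $q\equiv 3\pmod 6$, the value $0$ occurs $(q+1)/2$ times, the value $2$ occurs $(q-3)/2$ times, and the value $3$ occurs once; if $q\equiv 4\pmod 6$, the value $0$ occurs $q/2+1$ times, the value $2$ occurs $q/2-2$ times, and the value $4$ occurs once; if $q\equiv 5\pmod 6$, the value $0$ occurs $(q-1)/2$ times, the value $1$ occurs once, and the value $2$ occurs $(q-1)/2$ times.
   Context: An integer $s\ge 1$ is an invertible exponent over $L$ if $\gcd(s,q-1)=1$. For an invertible exponent $s$ and $v\in L$, $N(1,v)$ denotes the number of pairs $(x,y)\in L^2$ with $x+y=1$ and $x^s+y^s=v$ (the differential multiplicities of $s$). An invertible exponent $s$ is called nice over $L$ if $N(1,v)$ takes at most $3$ distinct values as $v$ runs through $L$. -}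

module Defs where

open import Level using (0ℓ)
open import Data.Nat using (ℕ; zero; suc; _≤_; _∸_)
open import Data.Nat.GCD using (gcd)
open import Data.Fin using (Fin)
import Data.Fin as Fin
open import Data.List using (List; length; filter; map; allFin; cartesianProduct)
open import Data.List.Membership.Propositional using (_∈_)
open import Data.Product using (_×_; _,_; ∃; proj₁; proj₂)
open import Relation.Nullary using (¬_; Dec; yes; no)
open import Relation.Nullary.Decidable using (_×-dec_)
open import Relation.Binary.Definitions using (DecidableEquality)
open import Relation.Binary.PropositionalEquality using (_≡_; refl; sym; trans; cong)
open import Algebra.Structures using (IsCommutativeRing)
open import Function.Bundles using (_↔_; Inverse)

record FiniteField : Set₁ where
  infixl 6 _+_
  infixl 7 _*_
  field
    Carrier : Set
    0# 1#   : Carrier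
    _+_ _*_ : Carrier → Carrier → Carrier
    -_      : Carrier → Carrier
    isCommutativeRing : IsCommutativeRing _≡_ _+_ _*_ -_ 0# 1#
    0≢1     : ¬ (0# ≡ 1#)
    inverse : ∀ x → ¬ (x ≡ 0#) → ∃ λ y → x * y ≡ 1#
    order   : ℕ
    enum    : Fin order ↔ Carrier

  infixr 8 _^_
  _^_ : Carrier → ℕ → Carrier
  x ^ zero  = 1#
  x ^ suc n = x * (x ^ n)

  _≟_ : DecidableEquality Carrier
  x ≟ y with Inverse.from enum x Fin.≟ Inverse.from enum y
  ... | yes p = yes (trans (sym (Inverse.strictlyInverseˡ enum x))
                      (trans (cong (Inverse.to enum) p) (Inverse.strictlyInverseˡ enum y)))
  ... | no ¬p = no (λ e → ¬p (cong (Inverse.from enum) e))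

  elements : List Carrier
  elements = map (Inverse.to enum) (allFin order)

  N1 : ℕ → Carrier → ℕ
  N1 s v = length (filter (λ p → ((proj₁ p + proj₂ p) ≟ 1#) ×-dec
                                  (((proj₁ p ^ s) + (proj₂ p ^ s)) ≟ v))
                          (cartesianProduct elements elements))

  occurrences : ℕ → ℕ → ℕ
  occurrences s k = length (filter (λ v → N1 s v Data.Nat.≟ k) elements)

  InvertibleExponent : ℕ → Set
  InvertibleExponent s = (1 ≤ s) × (gcd s (order ∸ 1) ≡ 1)

  Nice : ℕ → Set
  Nice s = InvertibleExponent s ×
           ∃ λ (vals : List ℕ) → (length vals ≤ 3) × (∀ v → N1 s v ∈ vals)

module Submission where

-- For s = q - 2 and q ≥ 3, Fermat's little theorem gives x^s = 1/x (with 1/0 = 0),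
-- so N(1, v) is the number of x with F x = v, where F x = 1/x + 1/(1 - x).  Off {0, 1}
-- F x = 1/G x for G x = x (1 - x), while F 0 = F 1 = 1.  With R c = #{x : G x = c}
-- this gives N(1, 0) = 0, N(1, 1) = R 1 + 2 and N(1, 1/c) = R c for c ∉ {0, 1}.  A
-- fibre of G is an orbit of τ x = 1 - x, so R c ≤ 2, and R c = 1 exactly at the value
-- of the (at most one) fixed point of τ.  Counting the values c ∉ {0, 1} by the size
-- k of their fibre (W k of them) yields linear relations between q, W 0, W 1, W 2 and
-- R 1; the map x ↦ 1/(1 - x), of order three on L ∖ {0, 1} and fixing there exactly
-- the solutions of x (1 - x) = 1, yields q ≡ 2 + R 1 (mod 3).  These data form the
-- record Profile, from which pure arithmetic recovers (W 1, R 1) from q mod 6 and then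
-- the whole distribution of N(1, v).

open import Defs
open import Level using (0ℓ)
open import Function using (_∘_)
open import Function.Bundles using (_↔_; _⇔_; Inverse; mk↔ₛ′; mk⇔)
open import Data.Empty using (⊥-elim)
open import Data.Unit using (tt)
open import Data.Product using (_×_; _,_; ∃; proj₁; proj₂)
open import Data.Sum using (_⊎_; inj₁; inj₂; [_,_]′)
open import Data.Nat as ℕ using (ℕ; zero; suc; _≤_; z≤n; s≤s; _⊓_; _∸_; _%_; _/_)
import Data.Nat.Properties as ℕP
open import Data.Nat.DivMod using ([m+kn]%n≡m%n; m*n/n≡m; m%n≤m)
open import Data.Nat.GCD using (gcd)
open import Data.Nat.Coprimality as Coprime using (coprime⇒gcd≡1; coprime-+; 1-coprimeTo)
open import Data.Nat.Tactic.RingSolver using (solve-∀)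
open import Data.Integer as ℤ using (ℤ; -[1+_]; _⊖_)
import Data.Integer.Properties as ℤP
import Data.Maybe as Maybe
open import Data.Fin as Fin using (Fin; toℕ)
import Data.Fin.Properties as FinP
open import Data.Fin.Permutation using (Permutation)
import Data.Vec as Vec
open import Data.List using (List; []; _∷_; length; filter; map; tabulate; allFin; cartesianProduct; lookup; _++_)
import Data.List.Properties as ListP
open import Data.List.Membership.Propositional using (_∈_)
open import Data.List.Relation.Unary.Any using (here; there; index)
open import Data.List.Relation.Unary.Any.Properties using (lookup-index)
open import Relation.Nullary using (¬_; Dec; yes; no; contradiction)
open import Relation.Nullary.Decidable using (_×-dec_; ¬?; toSum; toWitness; _→-dec_; dec⇒maybe)
open import Relation.Unary using (Pred; Decidable)
open import Relation.Binary.Definitions using (DecidableEquality)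
open import Relation.Binary.PropositionalEquality
open import Algebra.Bundles using (CommutativeMonoid; CommutativeRing)
open import Algebra.Structures using (IsCommutativeRing)
open import Algebra.Solver.Ring.AlmostCommutativeRing using (fromCommutativeRing; _-Raw-AlmostCommutative⟶_)
import Algebra.Properties.CommutativeMonoid.Sum as MonoidSum
import Algebra.Properties.Semiring.Sum as SemiringSum

-- Every commutative ring (with propositional equality) receives the canonical
-- homomorphism ℤ → R; instantiating the stdlib ring solver with it gives a
-- normaliser for polynomial identities with integer coefficients, used for all
-- ring identities in the field below.
module IntegerCoefficients
  {A : Set} {add mul : A → A → A} {neg : A → A} {0r 1r : A}
  (isCommutativeRing : IsCommutativeRing _≡_ add mul neg 0r 1r) where

  commutativeRing : CommutativeRing 0ℓ 0ℓ
  commutativeRing = record { isCommutativeRing = isCommutativeRing }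
  open CommutativeRing commutativeRing
    using (_+_; _*_; -_; 0#; 1#; +-assoc; +-comm; +-identityˡ; +-identityʳ; -‿inverseʳ; zeroˡ; zeroʳ;
           +-abelianGroup; semiring; ring)
  open import Algebra.Properties.AbelianGroup +-abelianGroup using (⁻¹-∙-comm; ⁻¹-involutive; ε⁻¹≈ε)
  open import Algebra.Properties.Ring ring using (-‿distribˡ-*; -‿distribʳ-*)
  open import Algebra.Properties.Semiring.Mult.TCOptimised semiring
    using (×-homo-+; ×1-homo-*) renaming (_×_ to _·_)
  open ≡-Reasoning

  ⟦_⟧ : ℤ → A
  ⟦ ℤ.+ n ⟧    = n · 1#
  ⟦ -[1+ n ] ⟧ = - (suc n · 1#)

  cancel-1 : ∀ a b → (1# + a) + - (1# + b) ≡ a + - b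
  cancel-1 a b = begin
    (1# + a) + - (1# + b)    ≡⟨ cong ((1# + a) +_) (sym (⁻¹-∙-comm 1# b)) ⟩
    (1# + a) + (- 1# + - b)  ≡⟨ +-assoc 1# a _ ⟩
    1# + (a + (- 1# + - b))  ≡⟨ cong (1# +_) (trans (sym (+-assoc a _ _)) (cong (_+ - b) (+-comm a _))) ⟩
    1# + ((- 1# + a) + - b)  ≡⟨ trans (cong (1# +_) (+-assoc _ a _)) (sym (+-assoc 1# _ _)) ⟩
    (1# + - 1#) + (a + - b)  ≡⟨ trans (cong (_+ (a + - b)) (-‿inverseʳ 1#)) (+-identityˡ _) ⟩
    a + - b                  ∎

  ⊖-homo : ∀ m n → ⟦ m ⊖ n ⟧ ≡ m · 1# + - (n · 1#)
  ⊖-homo zero    zero    = sym (trans (+-identityˡ _) ε⁻¹≈ε)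
  ⊖-homo (suc m) zero    = sym (trans (cong (suc m · 1# +_) ε⁻¹≈ε) (+-identityʳ _))
  ⊖-homo zero    (suc n) = sym (+-identityˡ _)
  ⊖-homo (suc m) (suc n) = begin
    ⟦ suc m ⊖ suc n ⟧                ≡⟨ cong ⟦_⟧ (ℤP.[1+m]⊖[1+n]≡m⊖n m n) ⟩
    ⟦ m ⊖ n ⟧                        ≡⟨ ⊖-homo m n ⟩
    m · 1# + - (n · 1#)              ≡⟨ cancel-1 (m · 1#) (n · 1#) ⟨
    (1# + m · 1#) + - (1# + n · 1#)  ≡⟨ cong₂ (λ a b → a + - b) (×-homo-+ 1# 1 m) (×-homo-+ 1# 1 n) ⟨
    suc m · 1# + - (suc n · 1#)      ∎

  +-homo : ∀ i j → ⟦ i ℤ.+ j ⟧ ≡ ⟦ i ⟧ + ⟦ j ⟧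
  +-homo (ℤ.+ m)  (ℤ.+ n)  = ×-homo-+ 1# m n
  +-homo (ℤ.+ m)  -[1+ n ] = ⊖-homo m (suc n)
  +-homo -[1+ m ] (ℤ.+ n)  = trans (⊖-homo n (suc m)) (+-comm _ _)
  +-homo -[1+ m ] -[1+ n ] = begin
    - (suc (suc (m ℕ.+ n)) · 1#)     ≡⟨ cong (λ k → - (suc k · 1#)) (sym (ℕP.+-suc m n)) ⟩
    - ((suc m ℕ.+ suc n) · 1#)       ≡⟨ cong -_ (×-homo-+ 1# (suc m) (suc n)) ⟩
    - (suc m · 1# + suc n · 1#)      ≡⟨ ⁻¹-∙-comm _ _ ⟨
    - (suc m · 1#) + - (suc n · 1#)  ∎

  neg-neg : ∀ a b → a * b ≡ (- a) * (- b)
  neg-neg a b = trans (sym (⁻¹-involutive _)) (trans (cong -_ (-‿distribʳ-* a b)) (-‿distribˡ-* a (- b)))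

  *-homo : ∀ i j → ⟦ i ℤ.* j ⟧ ≡ ⟦ i ⟧ * ⟦ j ⟧
  *-homo (ℤ.+ zero)  j           = sym (zeroˡ _)
  *-homo (ℤ.+ suc m) (ℤ.+ zero)  = trans (cong ⟦_⟧ (ℤP.*-zeroʳ (ℤ.+ suc m))) (sym (zeroʳ _))
  *-homo -[1+ m ]    (ℤ.+ zero)  = trans (cong ⟦_⟧ (ℤP.*-zeroʳ -[1+ m ])) (sym (zeroʳ _))
  *-homo (ℤ.+ suc m) (ℤ.+ suc n) = ×1-homo-* (suc m) (suc n)
  *-homo (ℤ.+ suc m) -[1+ n ]    = trans (cong -_ (×1-homo-* (suc m) (suc n))) (-‿distribʳ-* _ _)
  *-homo -[1+ m ]    (ℤ.+ suc n) = trans (cong -_ (×1-homo-* (suc m) (suc n))) (-‿distribˡ-* _ _)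
  *-homo -[1+ m ]    -[1+ n ]    = trans (×1-homo-* (suc m) (suc n)) (neg-neg _ _)

  -‿homo : ∀ i → ⟦ ℤ.- i ⟧ ≡ - ⟦ i ⟧
  -‿homo (ℤ.+ zero)  = sym ε⁻¹≈ε
  -‿homo (ℤ.+ suc n) = refl
  -‿homo -[1+ n ]    = sym (⁻¹-involutive _)

  ℤ-homomorphism : ℤ.+-*-rawRing -Raw-AlmostCommutative⟶ fromCommutativeRing commutativeRing
  ℤ-homomorphism = record
    { ⟦_⟧ = ⟦_⟧ ; +-homo = +-homo ; *-homo = *-homo ; -‿homo = -‿homo ; 0-homo = refl ; 1-homo = refl }

  open import Algebra.Solver.Ring ℤ.+-*-rawRing (fromCommutativeRing commutativeRing) ℤ-homomorphism
    (λ i j → Maybe.map (cong ⟦_⟧) (dec⇒maybe (i ℤ.≟ j)))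
    public using (solve; Polynomial; _:+_; _:*_; :-_; _:-_; _:=_; con)

module ℕSum = MonoidSum ℕP.+-0-commutativeMonoid
open ℕSum using (sum)

ι : ∀ {p} {P : Set p} → Dec P → ℕ
ι (yes _) = 1
ι (no _)  = 0

ι-yes : ∀ {p} {P : Set p} (d : Dec P) → P → ι d ≡ 1
ι-yes (yes _) _ = refl
ι-yes (no ¬p) p = contradiction p ¬p

ι-no : ∀ {p} {P : Set p} (d : Dec P) → ¬ P → ι d ≡ 0
ι-no (yes p) ¬p = contradiction p ¬p
ι-no (no _)  _  = refl

ι-cong : ∀ {p q} {P : Set p} {Q : Set q} (d : Dec P) (e : Dec Q) → (P → Q) → (Q → P) → ι d ≡ ι e
ι-cong (yes _) (yes _) _ _ = refl
ι-cong (yes p) (no ¬q) f _ = contradiction (f p) ¬q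
ι-cong (no ¬p) (yes q) _ g = contradiction (g q) ¬p
ι-cong (no _)  (no _)  _ _ = refl

ι-× : ∀ {p q} {P : Set p} {Q : Set q} (d : Dec P) (e : Dec Q) → ι (d ×-dec e) ≡ ι d ℕ.* ι e
ι-× (yes _) (yes _) = refl
ι-× (yes _) (no _)  = refl
ι-× (no _)  _       = refl

exactly-one : ∀ {p q r} {P : Set p} {Q : Set q} {R : Set r} (d : Dec P) (e : Dec Q) (f : Dec R) →
  P ⊎ Q ⊎ R → ¬ (P × Q) → ¬ (P × R) → ¬ (Q × R) → ι d ℕ.+ ι e ℕ.+ ι f ≡ 1
exactly-one (yes p) (yes q) _       _ ¬pq _   _   = contradiction (p , q) ¬pq
exactly-one (yes p) (no _)  (yes r) _ _   ¬pr _   = contradiction (p , r) ¬pr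
exactly-one (yes _) (no _)  (no _)  _ _   _   _   = refl
exactly-one (no _)  (yes q) (yes r) _ _   _   ¬qr = contradiction (q , r) ¬qr
exactly-one (no _)  (yes _) (no _)  _ _   _   _   = refl
exactly-one (no _)  (no _)  (yes _) _ _   _   _   = refl
exactly-one (no ¬p) (no ¬q) (no ¬r) h _   _   _   = ⊥-elim ([ ¬p , [ ¬q , ¬r ]′ ]′ h)

exactly-one-minimum : ∀ i j k → i ≢ j → j ≢ k → i ≢ k →
  let m = i ⊓ j ⊓ k in ι (i ℕ.≟ m) ℕ.+ ι (j ℕ.≟ m) ℕ.+ ι (k ℕ.≟ m) ≡ 1
exactly-one-minimum i j k i≢j j≢k i≢k =
  exactly-one (i ℕ.≟ m) (j ℕ.≟ m) (k ℕ.≟ m) attained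
    (λ (p , q) → i≢j (trans p (sym q))) (λ (p , r) → i≢k (trans p (sym r))) (λ (q , r) → j≢k (trans q (sym r)))
  where
  m : ℕ
  m = i ⊓ j ⊓ k
  attained : i ≡ m ⊎ j ≡ m ⊎ k ≡ m
  attained with ℕP.⊓-sel (i ⊓ j) k
  ... | inj₂ m≡k = inj₂ (inj₂ (sym m≡k))
  ... | inj₁ m≡ij with ℕP.⊓-sel i j
  ...   | inj₁ ij≡i = inj₁ (sym (trans m≡ij ij≡i))
  ...   | inj₂ ij≡j = inj₂ (inj₁ (sym (trans m≡ij ij≡j)))

sum-ones : ∀ n → sum {n} (λ _ → 1) ≡ n
sum-ones zero    = refl
sum-ones (suc n) = cong suc (sum-ones n)

sum-term : ∀ {n} (f : Fin n → ℕ) (i : Fin n) → f i ≤ sum f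
sum-term f Fin.zero    = ℕP.m≤m+n _ _
sum-term f (Fin.suc i) = ℕP.≤-trans (sum-term (f ∘ Fin.suc) i) (ℕP.m≤n+m _ _)

sum-mono : ∀ {n} (f g : Fin n → ℕ) → (∀ i → f i ≤ g i) → sum f ≤ sum g
sum-mono {zero}  f g h = z≤n
sum-mono {suc n} f g h = ℕP.+-mono-≤ (h Fin.zero) (sum-mono (f ∘ Fin.suc) (g ∘ Fin.suc) (h ∘ Fin.suc))

sum-δ : ∀ {n} (k : Fin n) → sum (λ i → ι (i FinP.≟ k)) ≡ 1
sum-δ {suc n} Fin.zero    = cong suc (trans (ℕSum.sum-cong-≗ {n} (λ i → ι-no (Fin.suc i FinP.≟ Fin.zero) λ ())) (sum-zero n))
  where
  sum-zero : ∀ m → sum {m} (λ _ → 0) ≡ 0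
  sum-zero zero = refl
  sum-zero (suc m) = sum-zero m
sum-δ {suc n} (Fin.suc k) = cong₂ ℕ._+_ (ι-no (Fin.zero FinP.≟ Fin.suc k) λ ())
  (trans (ℕSum.sum-cong-≗ {n} (λ i → ι-cong (Fin.suc i FinP.≟ Fin.suc k) (i FinP.≟ k) FinP.suc-injective (cong Fin.suc)))
         (sum-δ k))

length-filter-tabulate : ∀ {X : Set} {P : Pred X 0ℓ} (P? : Decidable P) {n} (h : Fin n → X) →
  length (filter P? (tabulate h)) ≡ sum (λ i → ι (P? (h i)))
length-filter-tabulate P? {zero}  h = refl
length-filter-tabulate P? {suc n} h with P? (h Fin.zero)
... | yes _ = cong suc (length-filter-tabulate P? (h ∘ Fin.suc))
... | no _  = length-filter-tabulate P? (h ∘ Fin.suc)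

length-filter-cartesianProduct : ∀ {X Y : Set} {P : Pred (X × Y) 0ℓ} (P? : Decidable P) {n} (h : Fin n → X) (ys : List Y) →
  length (filter P? (cartesianProduct (tabulate h) ys)) ≡ sum (λ i → length (filter P? (map (h i ,_) ys)))
length-filter-cartesianProduct P? {zero}  h ys = refl
length-filter-cartesianProduct {X} {Y} P? {suc n} h ys = begin
  length (filter P? (map (h Fin.zero ,_) ys ++ rest))                ≡⟨ cong length (ListP.filter-++ P? (map (h Fin.zero ,_) ys) rest) ⟩
  length (filter P? (map (h Fin.zero ,_) ys) ++ filter P? rest)      ≡⟨ ListP.length-++ (filter P? (map (h Fin.zero ,_) ys)) ⟩
  length (filter P? (map (h Fin.zero ,_) ys)) ℕ.+ length (filter P? rest)
    ≡⟨ cong (length (filter P? (map (h Fin.zero ,_) ys)) ℕ.+_) (length-filter-cartesianProduct P? (h ∘ Fin.suc) ys) ⟩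
  sum (λ i → length (filter P? (map (h i ,_) ys)))                   ∎
  where
  open ≡-Reasoning
  rest : List (X × Y)
  rest = cartesianProduct (tabulate (h ∘ Fin.suc)) ys

distinct-members : ∀ {X : Set} {m} (f : Fin m → X) → (∀ i j → f i ≡ f j → i ≡ j) →
  (xs : List X) → (∀ i → f i ∈ xs) → m ≤ length xs
distinct-members {m = m} f f-injective xs f∈xs with m ℕ.≤? length xs
... | yes m≤ = m≤
... | no  m≰ with FinP.pigeonhole (ℕP.≰⇒> m≰) (λ i → index (f∈xs i))
...   | i , j , i<j , same-index = contradiction (f-injective i j f[i]≡f[j]) (FinP.<⇒≢ i<j)
  where
  f[i]≡f[j] : f i ≡ f j
  f[i]≡f[j] = trans (lookup-index (f∈xs i)) (trans (cong (lookup xs) same-index) (sym (lookup-index (f∈xs j))))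

module Enumerated {A : Set} {n : ℕ} (enum : Fin n ↔ A) (_≟_ : DecidableEquality A) where
  open Inverse enum using (to; from; strictlyInverseˡ; strictlyInverseʳ)

  module BigOperator (M : CommutativeMonoid 0ℓ 0ℓ) where
    open CommutativeMonoid M using (Carrier; _≈_; _∙_) renaming (sym to ≈-sym; trans to ≈-trans; reflexive to ≈-reflexive)
    module S = MonoidSum M

    ⨁ : (A → Carrier) → Carrier
    ⨁ f = S.sum (f ∘ to)

    ⨁-distrib : ∀ (f g : A → Carrier) → ⨁ (λ x → f x ∙ g x) ≈ ⨁ f ∙ ⨁ g
    ⨁-distrib f g = S.∑-distrib-+ (f ∘ to) (g ∘ to)

    ⨁-reindex : ∀ (σ σ⁻¹ : A → A) → (∀ x → σ (σ⁻¹ x) ≡ x) → (∀ x → σ⁻¹ (σ x) ≡ x) →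
      ∀ f → ⨁ (f ∘ σ) ≈ ⨁ f
    ⨁-reindex σ σ⁻¹ σσ⁻¹ σ⁻¹σ f =
      ≈-sym (≈-trans (S.sum-permute (f ∘ to) π) (≈-reflexive (S.sum-cong-≗ (λ i → cong f (strictlyInverseˡ (σ (to i)))))))
      where
      π : Permutation n n
      π = mk↔ₛ′ (from ∘ σ ∘ to) (from ∘ σ⁻¹ ∘ to)
        (λ j → trans (cong (from ∘ σ) (strictlyInverseˡ _)) (trans (cong from (σσ⁻¹ _)) (strictlyInverseʳ j)))
        (λ i → trans (cong (from ∘ σ⁻¹) (strictlyInverseˡ _)) (trans (cong from (σ⁻¹σ _)) (strictlyInverseʳ i)))

  open BigOperator ℕP.+-0-commutativeMonoid public
    renaming (⨁ to ∑; ⨁-distrib to ∑-+; ⨁-reindex to ∑-reindex)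

  ∑-cong : ∀ {f g : A → ℕ} → (∀ x → f x ≡ g x) → ∑ f ≡ ∑ g
  ∑-cong f≗g = ℕSum.sum-cong-≗ (f≗g ∘ to)

  ∑-*ˡ : ∀ c (f : A → ℕ) → ∑ (λ x → c ℕ.* f x) ≡ c ℕ.* ∑ f
  ∑-*ˡ c f = sym (SemiringSum.*-distribˡ-sum ℕP.+-*-semiring c (f ∘ to))

  ∑-comm : ∀ (f : A → A → ℕ) → ∑ (λ x → ∑ (f x)) ≡ ∑ (λ y → ∑ (λ x → f x y))
  ∑-comm f = ℕSum.∑-comm (λ i j → f (to i) (to j))

  ∑-zero : ∀ (f : A → ℕ) → (∀ x → f x ≡ 0) → ∑ f ≡ 0
  ∑-zero f f≡0 = trans (∑-cong f≡0) (∑-*ˡ 0 (λ _ → 0))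

  ∑-ones : ∑ (λ _ → 1) ≡ n
  ∑-ones = sum-ones n

  ∑-term : ∀ (f : A → ℕ) a → f a ≤ ∑ f
  ∑-term f a = subst (λ z → f z ≤ ∑ f) (strictlyInverseˡ a) (sum-term (f ∘ to) (from a))

  ∑-mono : ∀ (f g : A → ℕ) → (∀ x → f x ≤ g x) → ∑ f ≤ ∑ g
  ∑-mono f g f≤g = sum-mono (f ∘ to) (g ∘ to) (f≤g ∘ to)

  ∑-δ : ∀ a → ∑ (λ x → ι (x ≟ a)) ≡ 1
  ∑-δ a = trans (∑-cong δ≡)
    (trans (ℕSum.sum-cong-≗ (λ i → cong (λ j → ι (j FinP.≟ from a)) (strictlyInverseʳ i))) (sum-δ (from a)))
    where
    δ≡ : ∀ x → ι (x ≟ a) ≡ ι (from x FinP.≟ from a)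
    δ≡ x = ι-cong (x ≟ a) (from x FinP.≟ from a) (cong from)
      (λ e → trans (sym (strictlyInverseˡ x)) (trans (cong to e) (strictlyInverseˡ a)))

  ∑-point : ∀ a (f : A → ℕ) → ∑ (λ x → ι (x ≟ a) ℕ.* f x) ≡ f a
  ∑-point a f = begin
    ∑ (λ x → ι (x ≟ a) ℕ.* f x)   ≡⟨ ∑-cong at-a ⟩
    ∑ (λ x → f a ℕ.* ι (x ≟ a))   ≡⟨ ∑-*ˡ (f a) (λ x → ι (x ≟ a)) ⟩
    f a ℕ.* ∑ (λ x → ι (x ≟ a))   ≡⟨ cong (f a ℕ.*_) (∑-δ a) ⟩
    f a ℕ.* 1                      ≡⟨ ℕP.*-identityʳ (f a) ⟩
    f a                            ∎
    where
    open ≡-Reasoning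
    at-a : ∀ x → ι (x ≟ a) ℕ.* f x ≡ f a ℕ.* ι (x ≟ a)
    at-a x with x ≟ a
    ... | yes refl = ℕP.*-comm 1 (f x)
    ... | no _     = sym (ℕP.*-zeroʳ (f a))

  count : ∀ {P : Pred A 0ℓ} → Decidable P → ℕ
  count P? = ∑ (λ x → ι (P? x))

  count-cong : ∀ {P Q : Pred A 0ℓ} (P? : Decidable P) (Q? : Decidable Q) →
    (∀ x → P x → Q x) → (∀ x → Q x → P x) → count P? ≡ count Q?
  count-cong P? Q? P⇒Q Q⇒P = ∑-cong (λ x → ι-cong (P? x) (Q? x) (P⇒Q x) (Q⇒P x))

  count-unique : ∀ {P : Pred A 0ℓ} (P? : Decidable P) a → P a → (∀ x → P x → x ≡ a) → count P? ≡ 1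
  count-unique P? a Pa unique = trans (count-cong P? (_≟ a) unique (λ { x refl → Pa })) (∑-δ a)

  count-none : ∀ {P : Pred A 0ℓ} (P? : Decidable P) → (∀ x → ¬ P x) → count P? ≡ 0
  count-none P? ¬P = ∑-zero _ (λ x → ι-no (P? x) (¬P x))

  count-at : ∀ {P Q : Pred A 0ℓ} (P? : Decidable P) (Q? : Decidable Q) a → (∀ x → P x → x ≡ a) → P a →
    count (λ x → P? x ×-dec Q? x) ≡ ι (Q? a)
  count-at P? Q? a P⇒a Pa = trans (∑-cong δ-form) (∑-point a (λ x → ι (Q? x)))
    where
    δ-form : ∀ x → ι (P? x ×-dec Q? x) ≡ ι (x ≟ a) ℕ.* ι (Q? x)
    δ-form x = trans (ι-× (P? x) (Q? x)) (cong (ℕ._* ι (Q? x)) (ι-cong (P? x) (x ≟ a) (P⇒a x) (λ { refl → Pa })))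

  search : ∀ {P : Pred A 0ℓ} (P? : Decidable P) → ∃ P ⊎ (∀ x → ¬ P x)
  search {P} P? with FinP.any? (P? ∘ to)
  ... | yes (i , p) = inj₁ (to i , p)
  ... | no none     = inj₂ (λ x p → none (from x , subst P (sym (strictlyInverseˡ x)) p))

  count-witness : ∀ {P : Pred A 0ℓ} (P? : Decidable P) → 1 ≤ count P? → ∃ P
  count-witness P? positive with search P?
  ... | inj₁ witness = witness
  ... | inj₂ none    = contradiction (subst (1 ≤_) (count-none P? none) positive) λ ()

  count-positive : ∀ {P : Pred A 0ℓ} (P? : Decidable P) a → P a → 1 ≤ count P?
  count-positive P? a Pa = subst (_≤ count P?) (ι-yes (P? a) Pa) (∑-term (λ x → ι (P? x)) a)

  count-≤1 : ∀ {P : Pred A 0ℓ} (P? : Decidable P) → (∀ x y → P x → P y → x ≡ y) → count P? ≤ 1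
  count-≤1 P? unique with search P?
  ... | inj₁ (a , Pa) = ℕP.≤-reflexive (count-unique P? a Pa (λ x Px → unique x a Px Pa))
  ... | inj₂ none     = subst (_≤ 1) (sym (count-none P? none)) z≤n

  count-≤2 : ∀ {P : Pred A 0ℓ} (P? : Decidable P) a b → (∀ x → P x → x ≡ a ⊎ x ≡ b) → count P? ≤ 2
  count-≤2 P? a b P⇒ab = ℕP.≤-trans (∑-mono _ _ bound)
    (ℕP.≤-reflexive (trans (∑-+ (λ x → ι (x ≟ a)) (λ x → ι (x ≟ b))) (cong₂ ℕ._+_ (∑-δ a) (∑-δ b))))
    where
    bound : ∀ x → ι (P? x) ≤ ι (x ≟ a) ℕ.+ ι (x ≟ b)
    bound x with P? x
    ... | no _ = z≤n
    ... | yes p with P⇒ab x p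
    ...   | inj₁ refl = subst (1 ≤_) (sym (cong (ℕ._+ ι (x ≟ b)) (ι-yes (x ≟ x) refl))) (s≤s z≤n)
    ...   | inj₂ refl = subst (1 ≤_) (sym (cong (ι (x ≟ a) ℕ.+_) (ι-yes (x ≟ x) refl))) (ℕP.m≤n+m 1 _)

  count-complement : ∀ a → count (λ x → ¬? (x ≟ a)) ℕ.+ 1 ≡ n
  count-complement a = trans (cong (count (λ x → ¬? (x ≟ a)) ℕ.+_) (sym (∑-δ a)))
    (trans (sym (∑-+ (λ x → ι (¬? (x ≟ a))) (λ x → ι (x ≟ a)))) (trans (∑-cong one) ∑-ones))
    where
    one : ∀ x → ι (¬? (x ≟ a)) ℕ.+ ι (x ≟ a) ≡ 1
    one x with x ≟ a
    ... | yes _ = refl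
    ... | no _  = refl

  outside : ∀ a b → Decidable (λ x → ¬ x ≡ a × ¬ x ≡ b)
  outside a b x = ¬? (x ≟ a) ×-dec ¬? (x ≟ b)

  ∑-split : ∀ {a b} → a ≢ b → (f : A → ℕ) → ∑ f ≡ f a ℕ.+ f b ℕ.+ ∑ (λ x → ι (outside a b x) ℕ.* f x)
  ∑-split {a} {b} a≢b f = begin
    ∑ f                                             ≡⟨ ∑-cong three-parts ⟩
    ∑ (λ x → ι (x ≟ a) ℕ.* f x ℕ.+ ι (x ≟ b) ℕ.* f x ℕ.+ rest x)
      ≡⟨ trans (∑-+ (λ x → ι (x ≟ a) ℕ.* f x ℕ.+ ι (x ≟ b) ℕ.* f x) rest)
               (cong (ℕ._+ ∑ rest) (∑-+ (λ x → ι (x ≟ a) ℕ.* f x) (λ x → ι (x ≟ b) ℕ.* f x))) ⟩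
    ∑ (λ x → ι (x ≟ a) ℕ.* f x) ℕ.+ ∑ (λ x → ι (x ≟ b) ℕ.* f x) ℕ.+ ∑ rest
      ≡⟨ cong (ℕ._+ ∑ rest) (cong₂ ℕ._+_ (∑-point a f) (∑-point b f)) ⟩
    f a ℕ.+ f b ℕ.+ ∑ rest                          ∎
    where
    open ≡-Reasoning
    rest : A → ℕ
    rest x = ι (outside a b x) ℕ.* f x
    weights : ∀ i j k → i ℕ.+ j ℕ.+ k ≡ 1 → ∀ m → m ≡ i ℕ.* m ℕ.+ j ℕ.* m ℕ.+ k ℕ.* m
    weights i j k total m = begin
      m                                     ≡⟨ ℕP.*-identityˡ m ⟨
      1 ℕ.* m                               ≡⟨ cong (ℕ._* m) total ⟨
      (i ℕ.+ j ℕ.+ k) ℕ.* m                 ≡⟨ ℕP.*-distribʳ-+ m (i ℕ.+ j) k ⟩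
      (i ℕ.+ j) ℕ.* m ℕ.+ k ℕ.* m           ≡⟨ cong (ℕ._+ k ℕ.* m) (ℕP.*-distribʳ-+ m i j) ⟩
      i ℕ.* m ℕ.+ j ℕ.* m ℕ.+ k ℕ.* m       ∎
    three-parts : ∀ x → f x ≡ ι (x ≟ a) ℕ.* f x ℕ.+ ι (x ≟ b) ℕ.* f x ℕ.+ rest x
    three-parts x with x ≟ a | x ≟ b
    ... | yes refl | yes refl = contradiction refl a≢b
    ... | yes _    | no _     = weights 1 0 0 refl (f x)
    ... | no _     | yes _    = weights 0 1 0 refl (f x)
    ... | no _     | no _     = weights 0 0 1 refl (f x)

  ∑-fibres : ∀ (g : A → A) {P : Pred A 0ℓ} (P? : Decidable P) →
    ∑ (λ c → count (λ x → (g x ≟ c) ×-dec P? x)) ≡ count P?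
  ∑-fibres g P? = trans (∑-comm (λ c x → ι ((g x ≟ c) ×-dec P? x))) (∑-cong (λ x → trans (∑-cong (δ-form x)) (∑-point (g x) (λ _ → ι (P? x)))))
    where
    δ-form : ∀ x c → ι ((g x ≟ c) ×-dec P? x) ≡ ι (c ≟ g x) ℕ.* ι (P? x)
    δ-form x c = trans (ι-× (g x ≟ c) (P? x)) (cong (ℕ._* ι (P? x)) (ι-cong (g x ≟ c) (c ≟ g x) sym sym))

  ∑-fibres-all : ∀ (g : A → A) → ∑ (λ c → count (λ x → g x ≟ c)) ≡ n
  ∑-fibres-all g = trans (∑-cong (λ c → count-cong (λ x → g x ≟ c) (λ x → (g x ≟ c) ×-dec yes tt)
                                                    (λ x e → e , tt) (λ x → proj₁)))
                         (trans (∑-fibres g (λ _ → yes tt)) ∑-ones)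

  enumeration : List A
  enumeration = map to (allFin n)

  count-list : ∀ {P : Pred A 0ℓ} (P? : Decidable P) → length (filter P? enumeration) ≡ count P?
  count-list P? = trans (cong (length ∘ filter P?) (ListP.map-tabulate (λ i → i) to)) (length-filter-tabulate P? to)

  count-pairs : ∀ {P : Pred (A × A) 0ℓ} (P? : Decidable P) →
    length (filter P? (cartesianProduct enumeration enumeration)) ≡ ∑ (λ x → count (λ y → P? (x , y)))
  count-pairs P? = begin
    length (filter P? (cartesianProduct enumeration enumeration))
      ≡⟨ cong (λ l → length (filter P? (cartesianProduct l l))) (ListP.map-tabulate (λ i → i) to) ⟩
    length (filter P? (cartesianProduct (tabulate to) (tabulate to)))
      ≡⟨ length-filter-cartesianProduct P? to (tabulate to) ⟩
    sum (λ i → length (filter P? (map (to i ,_) (tabulate to))))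
      ≡⟨ ℕSum.sum-cong-≗ (λ i → trans (cong (length ∘ filter P?) (ListP.map-tabulate to (to i ,_)))
                                       (length-filter-tabulate P? (λ j → to i , to j))) ⟩
    ∑ (λ x → count (λ y → P? (x , y)))  ∎
    where open ≡-Reasoning

  key : A → ℕ
  key x = toℕ (from x)

  key-injective : ∀ {x y} → key x ≡ key y → x ≡ y
  key-injective {x} {y} e = trans (sym (strictlyInverseˡ x)) (trans (cong to (FinP.toℕ-injective e)) (strictlyInverseˡ y))

  module OnSubset {D : Pred A 0ℓ} (D? : Decidable D) where

    extend : (A → A) → A → A
    extend g x with D? x
    ... | yes _ = g x
    ... | no _  = x

    extend-in : ∀ g {x} → D x → extend g x ≡ g x
    extend-in g {x} Dx with D? x
    ... | yes _  = refl
    ... | no ¬Dx = contradiction Dx ¬Dx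

    extend-out : ∀ g {x} → ¬ D x → extend g x ≡ x
    extend-out g {x} ¬Dx with D? x
    ... | yes Dx = contradiction Dx ¬Dx
    ... | no _   = refl

    ∑-reindex-on : ∀ (σ σ⁻¹ : A → A) → (∀ {x} → D x → D (σ x)) → (∀ {x} → D x → D (σ⁻¹ x)) →
      (∀ {x} → D x → σ (σ⁻¹ x) ≡ x) → (∀ {x} → D x → σ⁻¹ (σ x) ≡ x) →
      ∀ (f : A → ℕ) → ∑ (λ x → ι (D? x) ℕ.* f (σ x)) ≡ ∑ (λ x → ι (D? x) ℕ.* f x)
    ∑-reindex-on σ σ⁻¹ σ-D σ⁻¹-D σσ⁻¹ σ⁻¹σ f =
      trans (∑-cong agree) (∑-reindex (extend σ) (extend σ⁻¹) (inverse σ σ⁻¹ σ⁻¹-D σσ⁻¹) (inverse σ⁻¹ σ σ-D σ⁻¹σ) h)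
      where
      h : A → ℕ
      h x = ι (D? x) ℕ.* f x
      inverse : ∀ g g⁻¹ → (∀ {x} → D x → D (g⁻¹ x)) → (∀ {x} → D x → g (g⁻¹ x) ≡ x) →
        ∀ x → extend g (extend g⁻¹ x) ≡ x
      inverse g g⁻¹ g⁻¹-D gg⁻¹ x with toSum (D? x)
      ... | inj₁ Dx = trans (cong (extend g) (extend-in g⁻¹ Dx)) (trans (extend-in g (g⁻¹-D Dx)) (gg⁻¹ Dx))
      ... | inj₂ ¬Dx = trans (cong (extend g) (extend-out g⁻¹ ¬Dx)) (extend-out g ¬Dx)
      agree : ∀ x → ι (D? x) ℕ.* f (σ x) ≡ h (extend σ x)
      agree x with toSum (D? x)
      ... | inj₁ Dx  = trans (cong (ℕ._* f (σ x)) (trans (ι-yes (D? x) Dx) (sym (ι-yes (D? (σ x)) (σ-D Dx)))))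
                             (sym (cong h (extend-in σ Dx)))
      ... | inj₂ ¬Dx = trans (cong (ℕ._* f (σ x)) (ι-no (D? x) ¬Dx))
                             (sym (trans (cong h (extend-out σ ¬Dx)) (cong (ℕ._* f x) (ι-no (D? x) ¬Dx))))

  -- Every 3-cycle is counted once through its leader, the element of least key.
  module OrderThree (σ : A → A) {D : Pred A 0ℓ} (D? : Decidable D)
                    (σ-D : ∀ {x} → D x → D (σ x)) (σ³ : ∀ {x} → D x → σ (σ (σ x)) ≡ x) where
    open OnSubset D?

    orbit-min : A → ℕ
    orbit-min x = key x ⊓ key (σ x) ⊓ key (σ (σ x))

    leader? : Decidable (λ x → ¬ σ x ≡ x × key x ≡ orbit-min x)
    leader? x = ¬? (σ x ≟ x) ×-dec (key x ℕ.≟ orbit-min x)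

    leaders : A → ℕ
    leaders x = ι (leader? x) ℕ.+ ι (leader? (σ x)) ℕ.+ ι (leader? (σ (σ x)))

    no-leader : ∀ {x} → σ x ≡ x → leaders x ≡ 0
    no-leader {x} fixed = cong₂ ℕ._+_ (cong₂ ℕ._+_ (not-leader fixed) (not-leader (cong σ fixed)))
                                      (not-leader (cong σ (cong σ fixed)))
      where
      not-leader : ∀ {y} → σ y ≡ y → ι (leader? y) ≡ 0
      not-leader fy = ι-no (leader? _) (λ (moved , _) → moved fy)

    one-leader : ∀ {x} → D x → σ x ≢ x → leaders x ≡ 1
    one-leader {x} Dx moved = begin
      leaders x                                                  ≡⟨ cong₂ ℕ._+_ (cong₂ ℕ._+_ (by-key moved) (by-key moved₁)) (by-key moved₂) ⟩
      ι (i ℕ.≟ m) ℕ.+ ι (j ℕ.≟ orbit-min (σ x)) ℕ.+ ι (k ℕ.≟ orbit-min (σ (σ x)))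
        ≡⟨ cong₂ (λ m′ m″ → ι (i ℕ.≟ m) ℕ.+ ι (j ℕ.≟ m′) ℕ.+ ι (k ℕ.≟ m″)) min₁ min₂ ⟩
      ι (i ℕ.≟ m) ℕ.+ ι (j ℕ.≟ m) ℕ.+ ι (k ℕ.≟ m)                ≡⟨ exactly-one-minimum i j k
                                                                      (λ e → moved (sym (key-injective e)))
                                                                      (λ e → moved₁ (sym (key-injective e)))
                                                                      (λ e → moved₂ (trans (σ³ Dx) (key-injective e))) ⟩
      1                                                          ∎
      where
      open ≡-Reasoning
      i j k m : ℕ
      i = key x
      j = key (σ x)
      k = key (σ (σ x))
      m = i ⊓ j ⊓ k
      moved₁ : σ (σ x) ≢ σ x
      moved₁ e = moved (sym (trans (sym (σ³ Dx)) (trans (cong σ e) e)))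
      moved₂ : σ (σ (σ x)) ≢ σ (σ x)
      moved₂ e = moved (trans (cong σ (trans (sym (σ³ Dx)) e)) (σ³ Dx))
      by-key : ∀ {y} → σ y ≢ y → ι (leader? y) ≡ ι (key y ℕ.≟ orbit-min y)
      by-key {y} moved-y = ι-cong (leader? y) (key y ℕ.≟ orbit-min y) proj₂ (moved-y ,_)
      min₁ : orbit-min (σ x) ≡ m
      min₁ = begin
        j ⊓ k ⊓ key (σ (σ (σ x)))  ≡⟨ cong (λ z → j ⊓ k ⊓ key z) (σ³ Dx) ⟩
        j ⊓ k ⊓ i                  ≡⟨ ℕP.⊓-comm (j ⊓ k) i ⟩
        i ⊓ (j ⊓ k)                ≡⟨ ℕP.⊓-assoc i j k ⟨
        m                          ∎
      min₂ : orbit-min (σ (σ x)) ≡ m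
      min₂ = begin
        k ⊓ key (σ (σ (σ x))) ⊓ key (σ (σ (σ (σ x))))  ≡⟨ cong₂ (λ u v → k ⊓ key u ⊓ key v) (σ³ Dx) (cong σ (σ³ Dx)) ⟩
        k ⊓ i ⊓ j                                      ≡⟨ ℕP.⊓-assoc k i j ⟩
        k ⊓ (i ⊓ j)                                    ≡⟨ ℕP.⊓-comm k (i ⊓ j) ⟩
        m                                              ∎

    split-orbit : ∀ x → ι (D? x) ≡ ι (D? x ×-dec (σ x ≟ x)) ℕ.+ ι (D? x) ℕ.* leaders x
    split-orbit x with D? x
    ... | no _ = refl
    ... | yes Dx with toSum (σ x ≟ x)
    ...   | inj₁ fixed = sym (cong₂ (λ a b → a ℕ.+ 1 ℕ.* b) (ι-yes (yes Dx ×-dec (σ x ≟ x)) (Dx , fixed)) (no-leader fixed))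
    ...   | inj₂ moved = sym (cong₂ (λ a b → a ℕ.+ 1 ℕ.* b) (ι-no (yes Dx ×-dec (σ x ≟ x)) (moved ∘ proj₂)) (one-leader Dx moved))

    orbit-count : ∃ λ m → count D? ≡ count (λ x → D? x ×-dec (σ x ≟ x)) ℕ.+ 3 ℕ.* m
    orbit-count = ∑ (λ x → ι (D? x) ℕ.* ι (leader? x)) , (begin
      count D?                                              ≡⟨ ∑-cong split-orbit ⟩
      ∑ (λ x → fix x ℕ.+ ι (D? x) ℕ.* leaders x)            ≡⟨ ∑-+ fix (λ x → ι (D? x) ℕ.* leaders x) ⟩
      count fix? ℕ.+ ∑ (λ x → ι (D? x) ℕ.* leaders x)       ≡⟨ cong (count fix? ℕ.+_) three-sums ⟩
      count fix? ℕ.+ (m ℕ.+ m ℕ.+ m)                        ≡⟨ cong (count fix? ℕ.+_) (thrice m) ⟩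
      count fix? ℕ.+ 3 ℕ.* m                                ∎)
      where
      open ≡-Reasoning
      fix? : Decidable (λ x → D x × σ x ≡ x)
      fix? x = D? x ×-dec (σ x ≟ x)
      fix : A → ℕ
      fix x = ι (fix? x)
      ℓ : A → ℕ
      ℓ x = ι (leader? x)
      m : ℕ
      m = ∑ (λ x → ι (D? x) ℕ.* ℓ x)
      σ² : A → A
      σ² x = σ (σ x)
      distrib₃ : ∀ a b c d → a ℕ.* (b ℕ.+ c ℕ.+ d) ≡ a ℕ.* b ℕ.+ a ℕ.* c ℕ.+ a ℕ.* d
      distrib₃ = solve-∀
      thrice : ∀ k → k ℕ.+ k ℕ.+ k ≡ 3 ℕ.* k
      thrice = solve-∀
      three-sums : ∑ (λ x → ι (D? x) ℕ.* leaders x) ≡ m ℕ.+ m ℕ.+ m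
      three-sums = begin
        ∑ (λ x → ι (D? x) ℕ.* leaders x)
          ≡⟨ ∑-cong (λ x → distrib₃ (ι (D? x)) (ℓ x) (ℓ (σ x)) (ℓ (σ² x))) ⟩
        ∑ (λ x → ι (D? x) ℕ.* ℓ x ℕ.+ ι (D? x) ℕ.* ℓ (σ x) ℕ.+ ι (D? x) ℕ.* ℓ (σ² x))
          ≡⟨ trans (∑-+ (λ x → ι (D? x) ℕ.* ℓ x ℕ.+ ι (D? x) ℕ.* ℓ (σ x)) (λ x → ι (D? x) ℕ.* ℓ (σ² x)))
                   (cong (ℕ._+ ∑ (λ x → ι (D? x) ℕ.* ℓ (σ² x))) (∑-+ (λ x → ι (D? x) ℕ.* ℓ x) (λ x → ι (D? x) ℕ.* ℓ (σ x)))) ⟩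
        m ℕ.+ ∑ (λ x → ι (D? x) ℕ.* ℓ (σ x)) ℕ.+ ∑ (λ x → ι (D? x) ℕ.* ℓ (σ² x))
          ≡⟨ cong₂ (λ u v → m ℕ.+ u ℕ.+ v) (∑-reindex-on σ σ² σ-D (σ-D ∘ σ-D) σ³ σ³ ℓ)
                                            (∑-reindex-on σ² σ (σ-D ∘ σ-D) σ-D σ³ σ³ ℓ) ⟩
        m ℕ.+ m ℕ.+ m                                       ∎

module Arithmetic where
  open import Data.Nat using (_+_; _*_)
  open import Data.Nat.Tactic.RingSolver using (solve)

  mod-cong : ∀ n {a b} j k .{{_ : ℕ.NonZero n}} → a + j * n ≡ b + k * n → a % n ≡ b % n
  mod-cong n {a} {b} j k e = trans (sym ([m+kn]%n≡m%n a j n)) (trans (cong (_% n) e) ([m+kn]%n≡m%n b k n))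

  halve : ∀ m {x} → x ≡ m * 2 → x / 2 ≡ m
  halve m refl = m*n/n≡m m 2

  ι-partition : ∀ r → r ≤ 2 → ι (r ℕ.≟ 0) + ι (r ℕ.≟ 1) + ι (r ℕ.≟ 2) ≡ 1
  ι-partition 0 _ = refl
  ι-partition 1 _ = refl
  ι-partition 2 _ = refl
  ι-partition (suc (suc (suc _))) (s≤s (s≤s ()))

  ι-weight : ∀ r → r ≤ 2 → ι (r ℕ.≟ 1) + 2 * ι (r ℕ.≟ 2) ≡ r
  ι-weight 0 _ = refl
  ι-weight 1 _ = refl
  ι-weight 2 _ = refl
  ι-weight (suc (suc (suc _))) (s≤s (s≤s ()))

  ι-beyond : ∀ {r k} → r ≤ 2 → 3 ≤ k → ι (r ℕ.≟ k) ≡ 0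
  ι-beyond r≤2 3≤k = ι-no (_ ℕ.≟ _) (λ { refl → ℕP.≤⇒≯ r≤2 3≤k })

  ∸-suc : ∀ m k → k ℕ.< m → m ∸ k ≡ suc (m ∸ suc k)
  ∸-suc (suc m) zero    _         = refl
  ∸-suc (suc m) (suc k) (s≤s k<m) = ∸-suc m k k<m

  consecutive-coprime : ∀ n → gcd n (suc n) ≡ 1
  consecutive-coprime n = subst (λ m → gcd n m ≡ 1) (ℕP.+-comm n 1)
    (coprime⇒gcd≡1 (Coprime.sym (coprime-+ (1-coprimeTo n))))

  zero-one-two-four : Fin 4 → ℕ
  zero-one-two-four = Vec.lookup (0 Vec.∷ 1 Vec.∷ 2 Vec.∷ 4 Vec.∷ Vec.[])

  zero-one-two-four-injective : ∀ i j → zero-one-two-four i ≡ zero-one-two-four j → i ≡ j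
  zero-one-two-four-injective = toWitness {a? = FinP.all? λ i → FinP.all? λ j →
    (zero-one-two-four i ℕ.≟ zero-one-two-four j) →-dec (i FinP.≟ j)} _

  expected-W₁ : ℕ → ℕ
  expected-W₁ 1 = 1
  expected-W₁ 5 = 1
  expected-W₁ _ = 0

  expected-r₁ : ℕ → ℕ
  expected-r₁ 1 = 2
  expected-r₁ 3 = 1
  expected-r₁ 4 = 2
  expected-r₁ _ = 0

  shape-of : ∀ {w ρ r} → w + ι (ρ ℕ.≟ 1) ≤ 1 → ρ ≤ 2 → (3 * w + ρ + 2) % 6 ≡ r →
    w ≡ expected-W₁ r × ρ ≡ expected-r₁ r
  shape-of {0} {0} _ _ refl = refl , refl
  shape-of {0} {1} _ _ refl = refl , refl
  shape-of {0} {2} _ _ refl = refl , refl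
  shape-of {1} {0} _ _ refl = refl , refl
  shape-of {1} {1} (s≤s ()) _ _
  shape-of {1} {2} _ _ refl = refl , refl
  shape-of {suc (suc _)} (s≤s ()) _ _
  shape-of {0} {suc (suc (suc _))} _ (s≤s (s≤s ())) _
  shape-of {1} {suc (suc (suc _))} _ (s≤s (s≤s ())) _

  one-vanishes : ∀ w ρ → w + ι (ρ ℕ.≟ 1) ≤ 1 → ρ ≤ 2 → ¬ ((3 * w + ρ + 2) % 6 ≡ 1) → w ≡ 0 ⊎ ρ ≡ 0
  one-vanishes 0 ρ _ _ _ = inj₁ refl
  one-vanishes 1 0 _ _ _ = inj₂ refl
  one-vanishes 1 1 (s≤s ()) _ _
  one-vanishes 1 2 _ _ ≢1 = contradiction refl ≢1
  one-vanishes 1 (suc (suc (suc _))) _ (s≤s (s≤s ())) _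
  one-vanishes (suc (suc _)) _ (s≤s ()) _ _

  small-member : ∀ k → k ≤ 2 → k ∈ 0 ∷ 1 ∷ 2 ∷ []
  small-member 0 _ = here refl
  small-member 1 _ = there (here refl)
  small-member 2 _ = there (there (here refl))
  small-member (suc (suc (suc _))) (s≤s (s≤s ()))

  -- The counting data of the exponent q - 2 (occ k = number of v with N(1,v) = k).
  -- W k is the number of c ∉ {0,1} for which x(1-x) = c has exactly k solutions,
  -- r₁ the number of solutions of x(1-x) = 1.
  record Profile (q : ℕ) (occ : ℕ → ℕ) : Set where
    field
      W               : ℕ → ℕ
      r₁              : ℕ
      r₁≤2            : r₁ ≤ 2
      W-vanishes      : ∀ k → 3 ≤ k → W k ≡ 0
      -- both summands count fixed points of x ↦ 1 - x, of which there is at most one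
      fixed-points    : W 1 + ι (r₁ ℕ.≟ 1) ≤ 1
      count-values    : 2 + (W 0 + W 1 + W 2) ≡ q
      count-solutions : 2 + r₁ + (W 1 + 2 * W 2) ≡ q
      rotation        : ∃ λ m → 2 + (r₁ + 3 * m) ≡ q
      occurrences     : ∀ k → occ k ≡ ι (0 ℕ.≟ k) + ι (2 + r₁ ℕ.≟ k) + W k

  module ProfileArithmetic {q occ} (P : Profile q occ) where
    open Profile P

    q-form : q ≡ W 1 + r₁ + 2 + W 2 * 2
    q-form = trans (sym count-solutions) (rearrange r₁ (W 1) (W 2))
      where
      rearrange : ∀ a b c → 2 + a + (b + 2 * c) ≡ b + a + 2 + c * 2
      rearrange = solve-∀

    W₀-form : W 0 ≡ W 2 + r₁
    W₀-form = ℕP.+-cancelʳ-≡ (W 1 + W 2 + 2) (W 0) (W 2 + r₁)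
      (trans (rearrange₁ (W 0) (W 1) (W 2)) (trans count-values (trans (sym count-solutions) (rearrange₂ r₁ (W 1) (W 2)))))
      where
      rearrange₁ : ∀ a b c → a + (b + c + 2) ≡ 2 + (a + b + c)
      rearrange₁ = solve-∀
      rearrange₂ : ∀ a b c → 2 + a + (b + 2 * c) ≡ c + a + (b + c + 2)
      rearrange₂ = solve-∀

    occ₀ : occ 0 ≡ suc (W 2 + r₁)
    occ₀ = trans (occurrences 0) (cong suc W₀-form)

    occ₂₊ : ∀ j → occ (2 + j) ≡ ι (r₁ ℕ.≟ j) + W (2 + j)
    occ₂₊ j = trans (occurrences (2 + j))
      (cong (_+ W (2 + j)) (ι-cong (2 + r₁ ℕ.≟ 2 + j) (r₁ ℕ.≟ j) (ℕP.+-cancelˡ-≡ 2 r₁ j) (cong (2 +_))))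

    occ-high : ∀ j → 1 ≤ j → occ (2 + j) ≡ ι (r₁ ℕ.≟ j)
    occ-high j 1≤j = trans (occ₂₊ j) (trans (cong (ι (r₁ ℕ.≟ j) +_) (W-vanishes (2 + j) (s≤s (s≤s 1≤j))))
                                            (ℕP.+-identityʳ _))

    residue : q % 6 ≡ (3 * W 1 + r₁ + 2) % 6
    residue with rotation
    ... | m , rotated = mod-cong 6 {q} {3 * W 1 + r₁ + 2} m (W 2) (ℕP.+-cancelʳ-≡ (q + q) (q + m * 6) (3 * W 1 + r₁ + 2 + W 2 * 6) (begin
      q + m * 6 + (q + q)                             ≡⟨ cong (λ z → z + m * 6 + (z + z)) q-form ⟩
      x + m * 6 + (x + x)                             ≡⟨ combine (W 1) r₁ (W 2) m ⟩
      3 * W 1 + r₁ + 2 + W 2 * 6 + (y + y)            ≡⟨ cong (λ z → 3 * W 1 + r₁ + 2 + W 2 * 6 + (z + z)) rotated ⟩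
      3 * W 1 + r₁ + 2 + W 2 * 6 + (q + q)            ∎))
      where
      open ≡-Reasoning
      x y : ℕ
      x = W 1 + r₁ + 2 + W 2 * 2
      y = 2 + (r₁ + 3 * m)
      combine : ∀ w ρ t k → w + ρ + 2 + t * 2 + k * 6 + (w + ρ + 2 + t * 2 + (w + ρ + 2 + t * 2))
                          ≡ 3 * w + ρ + 2 + t * 6 + (2 + (ρ + 3 * k) + (2 + (ρ + 3 * k)))
      combine = solve-∀

    shape : ∀ {r} → q % 6 ≡ r → W 1 ≡ expected-W₁ r × r₁ ≡ expected-r₁ r
    shape e = shape-of fixed-points r₁≤2 (trans (sym residue) e)

    module Known {w ρ} (W₁≡w : W 1 ≡ w) (r₁≡ρ : r₁ ≡ ρ) where
      q≡ : q ≡ w + ρ + 2 + W 2 * 2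
      q≡ = trans q-form (cong₂ (λ a b → a + b + 2 + W 2 * 2) W₁≡w r₁≡ρ)

      occ0≡ : occ 0 ≡ suc (W 2 + ρ)
      occ0≡ = trans occ₀ (cong (λ b → suc (W 2 + b)) r₁≡ρ)

      occ1≡ : occ 1 ≡ w
      occ1≡ = trans (occurrences 1) W₁≡w

      occ2≡ : occ 2 ≡ ι (ρ ℕ.≟ 0) + W 2
      occ2≡ = trans (occ₂₊ 0) (cong (λ b → ι (b ℕ.≟ 0) + W 2) r₁≡ρ)

      occ2+≡ : ∀ j → 1 ≤ j → occ (2 + j) ≡ ι (ρ ℕ.≟ j)
      occ2+≡ j 1≤j = trans (occ-high j 1≤j) (cong (λ b → ι (b ℕ.≟ j)) r₁≡ρ)

    distribution₂ : q % 6 ≡ 2 → occ 0 ≡ q / 2 × occ 2 ≡ q / 2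
    distribution₂ e with shape e
    ... | W₁≡0 , r₁≡0 = halves (W 2) q≡ occ0≡ occ2≡
      where
      open Known W₁≡0 r₁≡0
      halves : ∀ t {n a b} → n ≡ 0 + 0 + 2 + t * 2 → a ≡ suc (t + 0) → b ≡ 1 + t → a ≡ n / 2 × b ≡ n / 2
      halves t refl refl refl = sym (halve (suc (t + 0)) double) , sym (halve (1 + t) double′)
        where
        double : 0 + 0 + 2 + t * 2 ≡ suc (t + 0) * 2
        double = solve (t ∷ [])
        double′ : 0 + 0 + 2 + t * 2 ≡ (1 + t) * 2
        double′ = solve (t ∷ [])

    distribution₃ : q % 6 ≡ 3 → occ 0 ≡ (q + 1) / 2 × occ 2 ≡ (q ∸ 3) / 2 × occ 3 ≡ 1
    distribution₃ e with shape e
    ... | W₁≡0 , r₁≡1 = proj₁ halved , proj₂ halved , occ2+≡ 1 (s≤s z≤n)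
      where
      open Known W₁≡0 r₁≡1
      halves : ∀ t {n a b} → n ≡ 0 + 1 + 2 + t * 2 → a ≡ suc (t + 1) → b ≡ 0 + t → a ≡ (n + 1) / 2 × b ≡ (n ∸ 3) / 2
      halves t refl refl refl = sym (halve (suc (t + 1)) double) , sym (halve t double′)
        where
        double : 0 + 1 + 2 + t * 2 + 1 ≡ suc (t + 1) * 2
        double = solve (t ∷ [])
        double′ : 0 + 1 + 2 + t * 2 ∸ 3 ≡ t * 2
        double′ = refl
      halved : occ 0 ≡ (q + 1) / 2 × occ 2 ≡ (q ∸ 3) / 2
      halved = halves (W 2) q≡ occ0≡ occ2≡

    distribution₄ : q % 6 ≡ 4 → occ 0 ≡ q / 2 + 1 × occ 2 ≡ q / 2 ∸ 2 × occ 4 ≡ 1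
    distribution₄ e with shape e
    ... | W₁≡0 , r₁≡2 = proj₁ halved , proj₂ halved , occ2+≡ 2 (s≤s z≤n)
      where
      open Known W₁≡0 r₁≡2
      halves : ∀ t {n a b} → n ≡ 0 + 2 + 2 + t * 2 → a ≡ suc (t + 2) → b ≡ 0 + t → a ≡ n / 2 + 1 × b ≡ n / 2 ∸ 2
      halves t refl refl refl = trans regroup (cong (_+ 1) (sym (halve (t + 2) double))) ,
                                trans (sym (ℕP.m+n∸n≡m t 2)) (cong (_∸ 2) (sym (halve (t + 2) double)))
        where
        double : 0 + 2 + 2 + t * 2 ≡ (t + 2) * 2
        double = solve (t ∷ [])
        regroup : suc (t + 2) ≡ t + 2 + 1
        regroup = solve (t ∷ [])
      halved : occ 0 ≡ q / 2 + 1 × occ 2 ≡ q / 2 ∸ 2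
      halved = halves (W 2) q≡ occ0≡ occ2≡

    distribution₅ : q % 6 ≡ 5 → occ 0 ≡ (q ∸ 1) / 2 × occ 1 ≡ 1 × occ 2 ≡ (q ∸ 1) / 2
    distribution₅ e with shape e
    ... | W₁≡1 , r₁≡0 = proj₁ halved , occ1≡ , proj₂ halved
      where
      open Known W₁≡1 r₁≡0
      halves : ∀ t {n a b} → n ≡ 1 + 0 + 2 + t * 2 → a ≡ suc (t + 0) → b ≡ 1 + t → a ≡ (n ∸ 1) / 2 × b ≡ (n ∸ 1) / 2
      halves t refl refl refl = sym (halve (suc (t + 0)) double) , sym (halve (1 + t) double′)
        where
        double : 2 + t * 2 ≡ suc (t + 0) * 2
        double = solve (t ∷ [])
        double′ : 2 + t * 2 ≡ (1 + t) * 2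
        double′ = solve (t ∷ [])
      halved : occ 0 ≡ (q ∸ 1) / 2 × occ 2 ≡ (q ∸ 1) / 2
      halved = halves (W 2) q≡ occ0≡ occ2≡

    attained : ∀ k → 1 ≤ occ k → k ≡ 0 ⊎ k ≡ 2 + r₁ ⊎ (k ≤ 2 × 1 ≤ W k)
    attained k positive with 0 ℕ.≟ k | 2 + r₁ ℕ.≟ k | subst (1 ≤_) (occurrences k) positive
    ... | yes 0≡k | _       | _    = inj₁ (sym 0≡k)
    ... | no _    | yes r≡k | _    = inj₂ (inj₁ (sym r≡k))
    ... | no _    | no _    | W≥1 with k ℕ.≤? 2
    ...   | yes k≤2 = inj₂ (inj₂ (k≤2 , W≥1))
    ...   | no k≰2  = contradiction (subst (1 ≤_) (W-vanishes k (ℕP.≰⇒> k≰2)) W≥1) λ ()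

    three-values : ¬ (q % 6 ≡ 1) → ∃ λ vals → length vals ≤ 3 × (∀ k → 1 ≤ occ k → k ∈ vals)
    three-values ≢1 with one-vanishes (W 1) r₁ fixed-points r₁≤2 (λ e → ≢1 (trans residue e))
    ... | inj₁ W₁≡0 = (0 ∷ 2 ∷ (2 + r₁) ∷ []) , ℕP.≤-refl , member
      where
      member : ∀ k → 1 ≤ occ k → k ∈ 0 ∷ 2 ∷ (2 + r₁) ∷ []
      member k positive with attained k positive
      ... | inj₁ refl = here refl
      ... | inj₂ (inj₁ refl) = there (there (here refl))
      ... | inj₂ (inj₂ (k≤2 , W≥1)) with small-member k k≤2
      ...   | here refl = here refl
      ...   | there (here refl) = contradiction (subst (1 ≤_) W₁≡0 W≥1) λ ()
      ...   | there (there (here refl)) = there (here refl)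
    ... | inj₂ r₁≡0 = (0 ∷ 1 ∷ 2 ∷ []) , ℕP.≤-refl , member
      where
      member : ∀ k → 1 ≤ occ k → k ∈ 0 ∷ 1 ∷ 2 ∷ []
      member k positive with attained k positive
      ... | inj₁ refl = here refl
      ... | inj₂ (inj₁ refl) = small-member (2 + r₁) (ℕP.≤-reflexive (cong (2 +_) r₁≡0))
      ... | inj₂ (inj₂ (k≤2 , _)) = small-member k k≤2

    four-values : q % 6 ≡ 1 → 1 ≤ occ 0 × 1 ≤ occ 1 × 1 ≤ occ 2 × 1 ≤ occ 4
    four-values e with shape e
    ... | W₁≡1 , r₁≡2 = at-least-one occ0≡ , ℕP.≤-reflexive (sym occ1≡) , W₂-positive , ℕP.≤-reflexive (sym (occ2+≡ 2 (s≤s z≤n)))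
      where
      open Known W₁≡1 r₁≡2
      at-least-one : ∀ {a b} → a ≡ suc b → 1 ≤ a
      at-least-one refl = s≤s z≤n
      -- W 2 = 0 would force q = 5
      W₂-positive : 1 ≤ occ 2
      W₂-positive with W 2 | q≡ | occ2≡
      ... | zero  | q≡5 | _  = contradiction (trans (sym e) (cong (_% 6) q≡5)) λ ()
      ... | suc _ | _   | o₂ = at-least-one o₂

open Arithmetic

module FieldFacts (L : FiniteField) where
  open FiniteField L
  open Enumerated enum _≟_
  open IntegerCoefficients isCommutativeRing using (commutativeRing; solve; Polynomial; _:+_; _:*_; :-_; _:-_; _:=_; con)
  open CommutativeRing commutativeRing using (_-_; +-identityˡ; +-identityʳ; -‿inverseʳ; zeroˡ; zeroʳ;
                                *-identityˡ; *-identityʳ; *-comm; *-assoc; *-commutativeMonoid)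
  open ≡-Reasoning

  q : ℕ
  q = order

  𝟏 : ∀ {n} → Polynomial n
  𝟏 = con (ℤ.+ 1)

  1≢0 : 1# ≢ 0#
  1≢0 = 0≢1 ∘ sym

  cancelˡ : ∀ a {x y} → a ≢ 0# → a * x ≡ a * y → x ≡ y
  cancelˡ a {x} {y} a≢0 ax≡ay = begin
    x            ≡⟨ undo x ⟩
    b * (a * x)  ≡⟨ cong (b *_) ax≡ay ⟩
    b * (a * y)  ≡⟨ undo y ⟨
    y            ∎
    where
    b : Carrier
    b = proj₁ (inverse a a≢0)
    undo : ∀ z → z ≡ b * (a * z)
    undo z = begin
      z            ≡⟨ *-identityˡ z ⟨
      1# * z       ≡⟨ cong (_* z) (trans (sym (proj₂ (inverse a a≢0))) (*-comm a b)) ⟩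
      b * a * z    ≡⟨ *-assoc b a z ⟩
      b * (a * z)  ∎

  no-zero-divisors : ∀ x y → x * y ≡ 0# → x ≡ 0# ⊎ y ≡ 0#
  no-zero-divisors x y xy≡0 with x ≟ 0#
  ... | yes x≡0 = inj₁ x≡0
  ... | no x≢0  = inj₂ (cancelˡ x x≢0 (trans xy≡0 (sym (zeroʳ x))))

  nonzero-product : ∀ {x y} → x ≢ 0# → y ≢ 0# → x * y ≢ 0#
  nonzero-product {x} {y} x≢0 y≢0 xy≡0 = [ x≢0 , y≢0 ]′ (no-zero-divisors x y xy≡0)

  inv : Carrier → Carrier
  inv x with x ≟ 0#
  ... | yes _   = 0#
  ... | no x≢0  = proj₁ (inverse x x≢0)

  inv-0 : inv 0# ≡ 0#
  inv-0 with 0# ≟ 0#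
  ... | yes _   = refl
  ... | no 0≢0  = contradiction refl 0≢0

  inverseʳ : ∀ {x} → x ≢ 0# → x * inv x ≡ 1#
  inverseʳ {x} x≢0 with x ≟ 0#
  ... | yes x≡0 = contradiction x≡0 x≢0
  ... | no x≢0′ = proj₂ (inverse x x≢0′)

  inv-unique : ∀ {x y} → x * y ≡ 1# → inv x ≡ y
  inv-unique {x} {y} xy≡1 with x ≟ 0#
  ... | yes x≡0 = contradiction (trans (sym xy≡1) (trans (cong (_* y) x≡0) (zeroˡ y))) 1≢0
  ... | no x≢0  = cancelˡ x x≢0 (trans (proj₂ (inverse x x≢0)) (sym xy≡1))

  inv-nonzero : ∀ {x} → x ≢ 0# → inv x ≢ 0#
  inv-nonzero {x} x≢0 inv≡0 = 1≢0 (trans (sym (inverseʳ x≢0)) (trans (cong (x *_) inv≡0) (zeroʳ x)))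

  inv-involutive : ∀ x → inv (inv x) ≡ x
  inv-involutive x with toSum (x ≟ 0#)
  ... | inj₁ x≡0 = trans (cong (inv ∘ inv) x≡0) (trans (cong inv inv-0) (trans inv-0 (sym x≡0)))
  ... | inj₂ x≢0 = inv-unique (trans (*-comm _ x) (inverseʳ x≢0))

  inv-1 : inv 1# ≡ 1#
  inv-1 = inv-unique (*-identityˡ 1#)

  -- Fermat's little theorem: a^(q-1) = 1 for a ≠ 0.  The product of the
  -- nonzero elements is unchanged when every element is multiplied by a.
  module Π = MonoidSum *-commutativeMonoid
  open BigOperator *-commutativeMonoid using () renaming (⨁ to ∏; ⨁-distrib to ∏-distrib; ⨁-reindex to ∏-reindex)

  ^-+ : ∀ x m n → x ^ (m ℕ.+ n) ≡ x ^ m * x ^ n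
  ^-+ x zero    n = sym (*-identityˡ _)
  ^-+ x (suc m) n = trans (cong (x *_) (^-+ x m n)) (sym (*-assoc x _ _))

  power-of-sum : ∀ {m} a (k : Fin m → ℕ) → Π.sum (λ i → a ^ k i) ≡ a ^ ℕSum.sum k
  power-of-sum {zero}  a k = refl
  power-of-sum {suc m} a k = trans (cong (a ^ k Fin.zero *_) (power-of-sum a (k ∘ Fin.suc))) (sym (^-+ a (k Fin.zero) _))

  product-nonzero : ∀ {m} (f : Fin m → Carrier) → (∀ i → f i ≢ 0#) → Π.sum f ≢ 0#
  product-nonzero {zero}  f f≢0 = 1≢0
  product-nonzero {suc m} f f≢0 = nonzero-product (f≢0 Fin.zero) (product-nonzero (f ∘ Fin.suc) (f≢0 ∘ Fin.suc))

  unit-part : Carrier → Carrier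
  unit-part x with x ≟ 0#
  ... | yes _ = 1#
  ... | no _  = x

  unit-part-nonzero : ∀ x → unit-part x ≢ 0#
  unit-part-nonzero x with x ≟ 0#
  ... | yes _   = 1≢0
  ... | no x≢0  = x≢0

  unit-part-scaled : ∀ {a} → a ≢ 0# → ∀ x → unit-part (a * x) ≡ a ^ ι (¬? (x ≟ 0#)) * unit-part x
  unit-part-scaled {a} a≢0 x with x ≟ 0# | (a * x) ≟ 0#
  ... | yes _   | yes _    = sym (*-identityˡ _)
  ... | yes x≡0 | no ax≢0  = contradiction (trans (cong (a *_) x≡0) (zeroʳ a)) ax≢0
  ... | no x≢0  | yes ax≡0 = contradiction ax≡0 (nonzero-product a≢0 x≢0)
  ... | no _    | no _     = cong (_* x) (sym (*-identityʳ a))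

  nonzero-count : count (λ x → ¬? (x ≟ 0#)) ≡ q ∸ 1
  nonzero-count = trans (sym (ℕP.m+n∸n≡m _ 1)) (cong (_∸ 1) (count-complement 0#))

  fermat : ∀ {a} → a ≢ 0# → a ^ (q ∸ 1) ≡ 1#
  fermat {a} a≢0 = cancelˡ P (product-nonzero (unit-part ∘ Inverse.to enum) (unit-part-nonzero ∘ Inverse.to enum))
    (begin
      P * a ^ (q ∸ 1)                                        ≡⟨ *-comm P _ ⟩
      a ^ (q ∸ 1) * P                                        ≡⟨ cong (_* P) (cong (a ^_) nonzero-count) ⟨
      a ^ count (λ x → ¬? (x ≟ 0#)) * P                      ≡⟨ cong (_* P) (power-of-sum a (λ i → ι (¬? (Inverse.to enum i ≟ 0#)))) ⟨
      ∏ (λ x → a ^ ι (¬? (x ≟ 0#))) * P                      ≡⟨ ∏-distrib (λ x → a ^ ι (¬? (x ≟ 0#))) unit-part ⟨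
      ∏ (λ x → a ^ ι (¬? (x ≟ 0#)) * unit-part x)            ≡⟨ Π.sum-cong-≗ (λ i → unit-part-scaled a≢0 (Inverse.to enum i)) ⟨
      ∏ (λ x → unit-part (a * x))                            ≡⟨ ∏-reindex (a *_) (inv a *_) scale-back scale-back′ unit-part ⟩
      P                                                      ≡⟨ *-identityʳ P ⟨
      P * 1#                                                 ∎)
    where
    P : Carrier
    P = ∏ unit-part
    scale-back : ∀ x → a * (inv a * x) ≡ x
    scale-back x = trans (sym (*-assoc a _ x)) (trans (cong (_* x) (inverseʳ a≢0)) (*-identityˡ x))
    scale-back′ : ∀ x → inv a * (a * x) ≡ x
    scale-back′ x = trans (sym (*-assoc _ a x)) (trans (cong (_* x) (trans (*-comm _ a) (inverseʳ a≢0))) (*-identityˡ x))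

  power-inverse : 3 ≤ q → ∀ x → x ^ (q ∸ 2) ≡ inv x
  power-inverse 3≤q x with toSum (x ≟ 0#)
  ... | inj₁ x≡0 = begin
    x ^ (q ∸ 2)          ≡⟨ cong (x ^_) (∸-suc q 2 3≤q) ⟩
    x * x ^ (q ∸ 3)      ≡⟨ trans (cong (_* x ^ (q ∸ 3)) x≡0) (zeroˡ _) ⟩
    0#                   ≡⟨ trans (sym inv-0) (cong inv (sym x≡0)) ⟩
    inv x                ∎
  ... | inj₂ x≢0 = sym (inv-unique (trans (cong (x ^_) (sym (∸-suc q 1 (ℕP.≤-trans (s≤s (s≤s z≤n)) 3≤q)))) (fermat x≢0)))

  invertible : 3 ≤ q → InvertibleExponent (q ∸ 2)
  invertible 3≤q = subst (1 ≤_) (sym (∸-suc q 2 3≤q)) (s≤s z≤n) ,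
                   subst (λ m → gcd (q ∸ 2) m ≡ 1) (sym (∸-suc q 1 (ℕP.≤-trans (s≤s (s≤s z≤n)) 3≤q))) (consecutive-coprime (q ∸ 2))

  τ : Carrier → Carrier
  τ x = 1# - x

  G : Carrier → Carrier
  G x = x * τ x

  F : Carrier → Carrier
  F x = inv x + inv (τ x)

  τ-0 : τ 0# ≡ 1#
  τ-0 = solve 0 (𝟏 :- con (ℤ.+ 0) := 𝟏) refl

  τ-1 : τ 1# ≡ 0#
  τ-1 = -‿inverseʳ 1#

  τ-involutive : ∀ x → τ (τ x) ≡ x
  τ-involutive = solve 1 (λ x → 𝟏 :- (𝟏 :- x) := x) refl

  G-τ : ∀ x → G (τ x) ≡ G x
  G-τ = solve 1 (λ x → (𝟏 :- x) :* (𝟏 :- (𝟏 :- x)) := x :* (𝟏 :- x)) refl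

  G-0 : G 0# ≡ 0#
  G-0 = zeroˡ _

  G-1 : G 1# ≡ 0#
  G-1 = trans (cong (1# *_) τ-1) (zeroʳ 1#)

  τ≡0 : ∀ {x} → τ x ≡ 0# → x ≡ 1#
  τ≡0 {x} τx≡0 = trans (sym (τ-involutive x)) (trans (cong τ τx≡0) τ-0)

  τ≢0 : ∀ {x} → x ≢ 1# → τ x ≢ 0#
  τ≢0 x≢1 = x≢1 ∘ τ≡0

  G≡0 : ∀ {x} → G x ≡ 0# → x ≡ 0# ⊎ x ≡ 1#
  G≡0 {x} Gx≡0 with no-zero-divisors x (τ x) Gx≡0
  ... | inj₁ x≡0  = inj₁ x≡0
  ... | inj₂ τx≡0 = inj₂ (τ≡0 τx≡0)

  G≢0 : ∀ {x} → x ≢ 0# → x ≢ 1# → G x ≢ 0#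
  G≢0 x≢0 x≢1 Gx≡0 = [ x≢0 , x≢1 ]′ (G≡0 Gx≡0)

  G-fibre : ∀ {x y} → G x ≡ G y → y ≡ x ⊎ y ≡ τ x
  G-fibre {x} {y} Gx≡Gy with no-zero-divisors (x - y) (1# - x - y) difference
    where
    difference : (x - y) * (1# - x - y) ≡ 0#
    difference = begin
      (x - y) * (1# - x - y)  ≡⟨ solve 2 (λ x y → (x :- y) :* (𝟏 :- x :- y) := x :* (𝟏 :- x) :- y :* (𝟏 :- y)) refl x y ⟩
      G x - G y               ≡⟨ cong (λ z → G x - z) (sym Gx≡Gy) ⟩
      G x - G x               ≡⟨ -‿inverseʳ (G x) ⟩
      0#                      ∎
  ... | inj₁ x-y≡0 = inj₁ (sym (trans (solve 2 (λ x y → x := (x :- y) :+ y) refl x y)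
                                      (trans (cong (_+ y) x-y≡0) (+-identityˡ y))))
  ... | inj₂ τ-y≡0 = inj₂ (trans (solve 2 (λ x y → y := (𝟏 :- x) :- (𝟏 :- x :- y)) refl x y)
                                 (trans (cong (λ z → τ x - z) τ-y≡0) (solve 1 (λ z → z :- con (ℤ.+ 0) := z) refl (τ x))))

  G-inverse-sum : ∀ {x} → x ≢ 0# → x ≢ 1# → inv (G x) ≡ F x
  G-inverse-sum {x} x≢0 x≢1 = inv-unique (begin
    x * τ x * (inv x + inv (τ x))               ≡⟨ solve 3 (λ x a b → x :* (𝟏 :- x) :* (a :+ b) := (𝟏 :- x) :* (x :* a) :+ x :* ((𝟏 :- x) :* b)) refl x (inv x) (inv (τ x)) ⟩
    τ x * (x * inv x) + x * (τ x * inv (τ x))   ≡⟨ cong₂ (λ u v → τ x * u + x * v) (inverseʳ x≢0) (inverseʳ (τ≢0 x≢1)) ⟩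
    τ x * 1# + x * 1#                           ≡⟨ solve 1 (λ x → (𝟏 :- x) :* 𝟏 :+ x :* 𝟏 := 𝟏) refl x ⟩
    1#                                          ∎)

  G-inverse-product : ∀ {x} → x ≢ 0# → x ≢ 1# → inv (G x) ≡ inv x * inv (τ x)
  G-inverse-product {x} x≢0 x≢1 = inv-unique (begin
    x * τ x * (inv x * inv (τ x))               ≡⟨ solve 4 (λ x y a b → x :* y :* (a :* b) := (x :* a) :* (y :* b)) refl x (τ x) (inv x) (inv (τ x)) ⟩
    (x * inv x) * (τ x * inv (τ x))             ≡⟨ cong₂ _*_ (inverseʳ x≢0) (inverseʳ (τ≢0 x≢1)) ⟩
    1# * 1#                                     ≡⟨ *-identityˡ 1# ⟩
    1#                                          ∎)

  R : Carrier → ℕ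
  R c = count (λ x → G x ≟ c)

  R≤2 : ∀ c → R c ≤ 2
  R≤2 c with search (λ x → G x ≟ c)
  ... | inj₁ (x , Gx≡c) = count-≤2 (λ y → G y ≟ c) x (τ x) (λ y Gy≡c → G-fibre (trans Gx≡c (sym Gy≡c)))
  ... | inj₂ none       = subst (_≤ 2) (sym (count-none (λ y → G y ≟ c) none)) z≤n

  R-0 : R 0# ≡ 2
  R-0 = begin
    R 0#                                          ≡⟨ ∑-split 0≢1 (λ x → ι (G x ≟ 0#)) ⟩
    ι (G 0# ≟ 0#) ℕ.+ ι (G 1# ≟ 0#) ℕ.+ ∑ rest   ≡⟨ cong₂ (λ a b → a ℕ.+ b ℕ.+ ∑ rest) (ι-yes (G 0# ≟ 0#) G-0) (ι-yes (G 1# ≟ 0#) G-1) ⟩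
    2 ℕ.+ ∑ rest                                  ≡⟨ cong (2 ℕ.+_) (∑-zero rest (λ x → nonzero x (outside 0# 1# x))) ⟩
    2                                             ∎
    where
    rest : Carrier → ℕ
    rest x = ι (outside 0# 1# x) ℕ.* ι (G x ≟ 0#)
    nonzero : ∀ x (d : Dec (x ≢ 0# × x ≢ 1#)) → ι d ℕ.* ι (G x ≟ 0#) ≡ 0
    nonzero x (yes (x≢0 , x≢1)) = trans (ℕP.*-identityˡ _) (ι-no (G x ≟ 0#) (G≢0 x≢0 x≢1))
    nonzero x (no _)            = refl

  R≥2 : ∀ {x} → τ x ≢ x → 2 ≤ R (G x)
  R≥2 {x} moved = subst (2 ≤_) (sym split) (ℕP.m≤m+n 2 rest)
    where
    rest : ℕ
    rest = ∑ (λ y → ι (outside x (τ x) y) ℕ.* ι (G y ≟ G x))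
    split : R (G x) ≡ 2 ℕ.+ rest
    split = trans (∑-split (moved ∘ sym) (λ y → ι (G y ≟ G x)))
      (cong₂ (λ a b → a ℕ.+ b ℕ.+ rest) (ι-yes (G x ≟ G x) refl) (ι-yes (G (τ x) ≟ G x) (G-τ x)))

  -- The fixed points of τ: solutions of 2x = 1, so there is at most one.
  fixed? : ∀ x → Dec (τ x ≡ x)
  fixed? x = τ x ≟ x

  fixed-double : ∀ {z} → τ z ≡ z → (1# + 1#) * z ≡ 1#
  fixed-double {z} τz≡z = begin
    (1# + 1#) * z  ≡⟨ solve 1 (λ z → (𝟏 :+ 𝟏) :* z := z :+ z) refl z ⟩
    z + z          ≡⟨ cong (_+ z) (sym τz≡z) ⟩
    τ z + z        ≡⟨ solve 1 (λ z → (𝟏 :- z) :+ z := 𝟏) refl z ⟩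
    1#             ∎

  fixed-difference : ∀ {x y} → τ x ≡ x → τ y ≡ y → (1# + 1#) * (x - y) ≡ 0#
  fixed-difference {x} {y} τx≡x τy≡y = begin
    (1# + 1#) * (x - y)              ≡⟨ solve 3 (λ t x y → t :* (x :- y) := t :* x :- t :* y) refl (1# + 1#) x y ⟩
    (1# + 1#) * x - (1# + 1#) * y    ≡⟨ cong₂ _-_ (fixed-double τx≡x) (fixed-double τy≡y) ⟩
    1# - 1#                          ≡⟨ -‿inverseʳ 1# ⟩
    0#                               ∎

  fixed-unique : ∀ {x y} → τ x ≡ x → τ y ≡ y → x ≡ y
  fixed-unique {x} {y} τx≡x τy≡y with no-zero-divisors (1# + 1#) (x - y) (fixed-difference τx≡x τy≡y)
  ... | inj₁ 2≡0   = contradiction (trans (sym (fixed-double τx≡x)) (trans (cong (_* x) 2≡0) (zeroˡ x))) 1≢0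
  ... | inj₂ x-y≡0 = trans (solve 2 (λ x y → x := (x :- y) :+ y) refl x y) (trans (cong (_+ y) x-y≡0) (+-identityˡ y))

  R≡1 : ∀ c → ι (R c ℕ.≟ 1) ≡ count (λ x → (G x ≟ c) ×-dec fixed? x)
  R≡1 c with search (λ x → (G x ≟ c) ×-dec fixed? x)
  ... | inj₁ (x , Gx≡c , τx≡x) =
    trans (cong (λ n → ι (n ℕ.≟ 1)) single)
          (sym (count-unique (λ y → (G y ≟ c) ×-dec fixed? y) x (Gx≡c , τx≡x) (λ y (_ , τy≡y) → fixed-unique τy≡y τx≡x)))
    where
    single : R c ≡ 1
    single = count-unique (λ y → G y ≟ c) x Gx≡c
      (λ y Gy≡c → [ (λ y≡x → y≡x) , (λ y≡τx → trans y≡τx τx≡x) ]′ (G-fibre (trans Gx≡c (sym Gy≡c))))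
  ... | inj₂ none = trans (ι-no (R c ℕ.≟ 1) not-single) (sym (count-none (λ x → (G x ≟ c) ×-dec fixed? x) none))
    where
    not-single : R c ≢ 1
    not-single R≡1 with count-witness (λ y → G y ≟ c) (ℕP.≤-reflexive (sym R≡1))
    ... | x , Gx≡c = contradiction (subst (2 ≤_) (trans (cong R Gx≡c) R≡1) (R≥2 (λ τx≡x → none x (Gx≡c , τx≡x)))) λ { (s≤s ()) }

  fixed-count : ∑ (λ c → ι (R c ℕ.≟ 1)) ≡ count fixed?
  fixed-count = trans (∑-cong R≡1) (∑-fibres G fixed?)

  ρ : Carrier → Carrier
  ρ x = inv (τ x)

  Off : Carrier → Set
  Off x = x ≢ 0# × x ≢ 1#

  off? : ∀ x → Dec (Off x)
  off? = outside 0# 1#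

  ρ-off : ∀ {x} → Off x → Off (ρ x)
  ρ-off {x} (x≢0 , x≢1) = inv-nonzero (τ≢0 x≢1) , λ ρx≡1 → x≢0 (begin
    x              ≡⟨ τ-involutive x ⟨
    τ (τ x)        ≡⟨ cong τ (trans (sym (inv-involutive (τ x))) (trans (cong inv ρx≡1) inv-1)) ⟩
    τ 1#           ≡⟨ τ-1 ⟩
    0#             ∎)

  ρ² : ∀ {x} → Off x → ρ (ρ x) ≡ τ (inv x)
  ρ² {x} (x≢0 , x≢1) = inv-unique (begin
    τ b * τ a              ≡⟨ solve 2 (λ a b → (𝟏 :- b) :* (𝟏 :- a) := 𝟏 :- (a :+ b) :+ a :* b) refl a b ⟩
    1# - (a + b) + a * b   ≡⟨ cong (λ z → 1# - z + a * b) sum≡product ⟩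
    1# - a * b + a * b     ≡⟨ solve 1 (λ z → 𝟏 :- z :+ z := 𝟏) refl (a * b) ⟩
    1#                     ∎)
    where
    a b : Carrier
    a = inv x
    b = inv (τ x)
    sum≡product : a + b ≡ a * b
    sum≡product = trans (sym (G-inverse-sum x≢0 x≢1)) (G-inverse-product x≢0 x≢1)

  ρ³ : ∀ {x} → Off x → ρ (ρ (ρ x)) ≡ x
  ρ³ {x} off = trans (ρ² (ρ-off off)) (trans (cong τ (inv-involutive (τ x))) (τ-involutive x))

  ρ-fixed : ∀ x → Off x × ρ x ≡ x → G x ≡ 1#
  ρ-fixed x ((_ , x≢1) , ρx≡x) = begin
    x * τ x         ≡⟨ cong (_* τ x) (sym ρx≡x) ⟩
    inv (τ x) * τ x ≡⟨ *-comm _ (τ x) ⟩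
    τ x * inv (τ x) ≡⟨ inverseʳ (τ≢0 x≢1) ⟩
    1#              ∎

  fixed-ρ : ∀ x → G x ≡ 1# → Off x × ρ x ≡ x
  fixed-ρ x Gx≡1 = (x≢0 , x≢1) , inv-unique (trans (*-comm (τ x) x) Gx≡1)
    where
    x≢0 : x ≢ 0#
    x≢0 x≡0 = 1≢0 (trans (sym Gx≡1) (trans (cong G x≡0) G-0))
    x≢1 : x ≢ 1#
    x≢1 x≡1 = 1≢0 (trans (sym Gx≡1) (trans (cong G x≡1) G-1))

  off-count : 2 ℕ.+ count off? ≡ q
  off-count = sym (begin
    q                                        ≡⟨ ∑-ones ⟨
    ∑ (λ _ → 1)                              ≡⟨ ∑-split 0≢1 (λ _ → 1) ⟩
    2 ℕ.+ ∑ (λ x → ι (off? x) ℕ.* 1)         ≡⟨ cong (2 ℕ.+_) (∑-cong (λ x → ℕP.*-identityʳ (ι (off? x)))) ⟩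
    2 ℕ.+ count off?                         ∎)

  rotation : ∃ λ m → 2 ℕ.+ (R 1# ℕ.+ 3 ℕ.* m) ≡ q
  rotation = proj₁ orbits , (begin
    2 ℕ.+ (R 1# ℕ.+ 3 ℕ.* m)                                    ≡⟨ cong (λ n → 2 ℕ.+ (n ℕ.+ 3 ℕ.* m)) fixed-solutions ⟨
    2 ℕ.+ (count (λ x → off? x ×-dec (ρ x ≟ x)) ℕ.+ 3 ℕ.* m)    ≡⟨ cong (2 ℕ.+_) (proj₂ orbits) ⟨
    2 ℕ.+ count off?                                            ≡⟨ off-count ⟩
    q                                                           ∎)
    where
    orbits : ∃ λ m → count off? ≡ count (λ x → off? x ×-dec (ρ x ≟ x)) ℕ.+ 3 ℕ.* m
    orbits = OrderThree.orbit-count ρ off? ρ-off ρ³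
    m : ℕ
    m = proj₁ orbits
    fixed-solutions : count (λ x → off? x ×-dec (ρ x ≟ x)) ≡ R 1#
    fixed-solutions = count-cong (λ x → off? x ×-dec (ρ x ≟ x)) (λ x → G x ≟ 1#) ρ-fixed fixed-ρ

  -- N(1, v) counts the x with x^s + (1 - x)^s = v, since y = 1 - x is forced.
  N1-line : ∀ s v → N1 s v ≡ count (λ x → (x ^ s + τ x ^ s) ≟ v)
  N1-line s v = trans (count-pairs (λ p → ((proj₁ p + proj₂ p) ≟ 1#) ×-dec (((proj₁ p ^ s) + (proj₂ p ^ s)) ≟ v)))
                      (∑-cong line)
    where
    line : ∀ x → count (λ y → ((x + y) ≟ 1#) ×-dec ((x ^ s + y ^ s) ≟ v)) ≡ ι ((x ^ s + τ x ^ s) ≟ v)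
    line x = count-at (λ y → (x + y) ≟ 1#) (λ y → (x ^ s + y ^ s) ≟ v) (τ x)
      (λ y x+y≡1 → trans (solve 2 (λ x y → y := (x :+ y) :- x) refl x y) (cong (_- x) x+y≡1))
      (solve 1 (λ x → x :+ (𝟏 :- x) := 𝟏) refl x)

  occurrences-count : ∀ s k → occurrences s k ≡ count (λ v → N1 s v ℕ.≟ k)
  occurrences-count s k = count-list (λ v → N1 s v ℕ.≟ k)

  value-attained : ∀ s v → 1 ≤ occurrences s (N1 s v)
  value-attained s v = subst (1 ≤_) (sym (occurrences-count s (N1 s v))) (count-positive (λ w → N1 s w ℕ.≟ N1 s v) v refl)

  attained-value : ∀ s k → 1 ≤ occurrences s k → ∃ λ v → N1 s v ≡ k
  attained-value s k positive = count-witness (λ v → N1 s v ℕ.≟ k) (subst (1 ≤_) (occurrences-count s k) positive)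

  F-0 : F 0# ≡ 1#
  F-0 = trans (cong₂ _+_ inv-0 (trans (cong inv τ-0) inv-1)) (+-identityˡ 1#)

  F-1 : F 1# ≡ 1#
  F-1 = trans (cong₂ _+_ inv-1 (trans (cong inv τ-1) inv-0)) (+-identityʳ 1#)

  F-edge : ∀ {x} → ¬ Off x → F x ≡ 1#
  F-edge {x} edge with toSum (x ≟ 0#) | toSum (x ≟ 1#)
  ... | inj₁ x≡0 | _        = trans (cong F x≡0) F-0
  ... | inj₂ _   | inj₁ x≡1 = trans (cong F x≡1) F-1
  ... | inj₂ x≢0 | inj₂ x≢1 = contradiction (x≢0 , x≢1) edge

  module ExponentQMinusTwo (3≤q : 3 ≤ q) where

    N : Carrier → ℕ
    N = N1 (q ∸ 2)

    N-F : ∀ v → N v ≡ count (λ x → F x ≟ v)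
    N-F v = trans (N1-line (q ∸ 2) v) (count-cong (λ x → (x ^ (q ∸ 2) + τ x ^ (q ∸ 2)) ≟ v) (λ x → F x ≟ v)
      (λ x e → trans (sym (power-sums x)) e) (λ x e → trans (power-sums x) e))
      where
      power-sums : ∀ x → x ^ (q ∸ 2) + τ x ^ (q ∸ 2) ≡ F x
      power-sums x = cong₂ _+_ (power-inverse 3≤q x) (power-inverse 3≤q (τ x))

    N-0 : N 0# ≡ 0
    N-0 = trans (N-F 0#) (count-none (λ x → F x ≟ 0#) F≢0)
      where
      F≢0 : ∀ x → F x ≢ 0#
      F≢0 x with off? x
      ... | yes (x≢0 , x≢1) = λ F≡0 → inv-nonzero (G≢0 x≢0 x≢1) (trans (G-inverse-sum x≢0 x≢1) F≡0)
      ... | no edge         = λ F≡0 → 1≢0 (trans (sym (F-edge edge)) F≡0)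

    -- Off {0,1} the equation F x = 1/c is equivalent to G x = c; at 0 and 1, F = 1.
    N-inv : ∀ {c} → c ≢ 0# → N (inv c) ≡ ι (1# ≟ inv c) ℕ.+ ι (1# ≟ inv c) ℕ.+ R c
    N-inv {c} c≢0 = begin
      N (inv c)                                                         ≡⟨ N-F (inv c) ⟩
      count (λ x → F x ≟ inv c)                                         ≡⟨ ∑-split 0≢1 (λ x → ι (F x ≟ inv c)) ⟩
      ι (F 0# ≟ inv c) ℕ.+ ι (F 1# ≟ inv c) ℕ.+ ∑ (λ x → ι (off? x) ℕ.* ι (F x ≟ inv c))
        ≡⟨ cong₂ (λ a b → a ℕ.+ b ℕ.+ ∑ (λ x → ι (off? x) ℕ.* ι (F x ≟ inv c))) (cong (λ y → ι (y ≟ inv c)) F-0) (cong (λ y → ι (y ≟ inv c)) F-1) ⟩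
      ι (1# ≟ inv c) ℕ.+ ι (1# ≟ inv c) ℕ.+ ∑ (λ x → ι (off? x) ℕ.* ι (F x ≟ inv c))
        ≡⟨ cong (ι (1# ≟ inv c) ℕ.+ ι (1# ≟ inv c) ℕ.+_) (trans (∑-cong same-rest) (sym R-rest)) ⟩
      ι (1# ≟ inv c) ℕ.+ ι (1# ≟ inv c) ℕ.+ R c                         ∎
      where
      same-rest : ∀ x → ι (off? x) ℕ.* ι (F x ≟ inv c) ≡ ι (off? x) ℕ.* ι (G x ≟ c)
      same-rest x with off? x
      ... | no _ = refl
      ... | yes (x≢0 , x≢1) = cong (1 ℕ.*_) (ι-cong (F x ≟ inv c) (G x ≟ c)
        (λ F≡ → trans (sym (inv-involutive (G x))) (trans (cong inv (trans (G-inverse-sum x≢0 x≢1) F≡)) (inv-involutive c)))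
        (λ G≡ → trans (sym (G-inverse-sum x≢0 x≢1)) (cong inv G≡)))
      R-rest : R c ≡ ∑ (λ x → ι (off? x) ℕ.* ι (G x ≟ c))
      R-rest = trans (∑-split 0≢1 (λ x → ι (G x ≟ c)))
        (cong₂ (λ a b → a ℕ.+ b ℕ.+ ∑ (λ x → ι (off? x) ℕ.* ι (G x ≟ c))) (ι-no (G 0# ≟ c) (λ e → c≢0 (trans (sym e) G-0)))
                                        (ι-no (G 1# ≟ c) (λ e → c≢0 (trans (sym e) G-1))))

    W : ℕ → ℕ
    W k = ∑ (λ c → ι (off? c) ℕ.* ι (R c ℕ.≟ k))

    occurrences-formula : ∀ k → occurrences (q ∸ 2) k ≡ ι (0 ℕ.≟ k) ℕ.+ ι (2 ℕ.+ R 1# ℕ.≟ k) ℕ.+ W k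
    occurrences-formula k = begin
      occurrences (q ∸ 2) k                              ≡⟨ occurrences-count (q ∸ 2) k ⟩
      ∑ (λ v → ι (N v ℕ.≟ k))                            ≡⟨ ∑-reindex inv inv inv-involutive inv-involutive (λ v → ι (N v ℕ.≟ k)) ⟨
      ∑ (λ c → ι (N (inv c) ℕ.≟ k))                      ≡⟨ ∑-split 0≢1 (λ c → ι (N (inv c) ℕ.≟ k)) ⟩
      ι (N (inv 0#) ℕ.≟ k) ℕ.+ ι (N (inv 1#) ℕ.≟ k) ℕ.+ ∑ (λ c → ι (off? c) ℕ.* ι (N (inv c) ℕ.≟ k))
        ≡⟨ cong₂ (λ a b → ι (a ℕ.≟ k) ℕ.+ ι (b ℕ.≟ k) ℕ.+ ∑ (λ c → ι (off? c) ℕ.* ι (N (inv c) ℕ.≟ k))) (trans (cong N inv-0) N-0) N-inv-1 ⟩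
      ι (0 ℕ.≟ k) ℕ.+ ι (2 ℕ.+ R 1# ℕ.≟ k) ℕ.+ ∑ (λ c → ι (off? c) ℕ.* ι (N (inv c) ℕ.≟ k))
        ≡⟨ cong (ι (0 ℕ.≟ k) ℕ.+ ι (2 ℕ.+ R 1# ℕ.≟ k) ℕ.+_) (∑-cong generic) ⟩
      ι (0 ℕ.≟ k) ℕ.+ ι (2 ℕ.+ R 1# ℕ.≟ k) ℕ.+ W k      ∎
      where
      N-inv-1 : N (inv 1#) ≡ 2 ℕ.+ R 1#
      N-inv-1 = trans (N-inv 1≢0) (cong (λ i → i ℕ.+ i ℕ.+ R 1#) (ι-yes (1# ≟ inv 1#) (sym inv-1)))
      generic : ∀ c → ι (off? c) ℕ.* ι (N (inv c) ℕ.≟ k) ≡ ι (off? c) ℕ.* ι (R c ℕ.≟ k)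
      generic c with off? c
      ... | no _ = refl
      ... | yes (c≢0 , c≢1) = cong (λ n → 1 ℕ.* ι (n ℕ.≟ k)) (trans (N-inv c≢0)
        (cong (λ i → i ℕ.+ i ℕ.+ R c) (ι-no (1# ≟ inv c) (λ 1≡ → c≢1 (trans (sym (inv-involutive c)) (trans (cong inv (sym 1≡)) inv-1))))))

    W-vanishes : ∀ k → 3 ≤ k → W k ≡ 0
    W-vanishes k 3≤k = ∑-zero (λ c → ι (off? c) ℕ.* ι (R c ℕ.≟ k)) (λ c → trans (cong (ι (off? c) ℕ.*_) (ι-beyond (R≤2 c) 3≤k)) (ℕP.*-zeroʳ (ι (off? c))))

    count-values : 2 ℕ.+ (W 0 ℕ.+ W 1 ℕ.+ W 2) ≡ q
    count-values = trans (cong (2 ℕ.+_) (sym by-size)) off-count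
      where
      by-size : count off? ≡ W 0 ℕ.+ W 1 ℕ.+ W 2
      by-size = begin
        ∑ (λ c → ι (off? c))   ≡⟨ ∑-cong (λ c → split (ι (off? c)) (R c) (R≤2 c)) ⟩
        ∑ (λ c → ι (off? c) ℕ.* ι (R c ℕ.≟ 0) ℕ.+ ι (off? c) ℕ.* ι (R c ℕ.≟ 1) ℕ.+ ι (off? c) ℕ.* ι (R c ℕ.≟ 2))
          ≡⟨ trans (∑-+ (λ c → ι (off? c) ℕ.* ι (R c ℕ.≟ 0) ℕ.+ ι (off? c) ℕ.* ι (R c ℕ.≟ 1)) (λ c → ι (off? c) ℕ.* ι (R c ℕ.≟ 2)))
                   (cong (ℕ._+ W 2) (∑-+ (λ c → ι (off? c) ℕ.* ι (R c ℕ.≟ 0)) (λ c → ι (off? c) ℕ.* ι (R c ℕ.≟ 1)))) ⟩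
        W 0 ℕ.+ W 1 ℕ.+ W 2    ∎
        where
        split : ∀ a r → r ≤ 2 → a ≡ a ℕ.* ι (r ℕ.≟ 0) ℕ.+ a ℕ.* ι (r ℕ.≟ 1) ℕ.+ a ℕ.* ι (r ℕ.≟ 2)
        split a r r≤2 = begin
          a                                  ≡⟨ ℕP.*-identityʳ a ⟨
          a ℕ.* 1                            ≡⟨ cong (a ℕ.*_) (ι-partition r r≤2) ⟨
          a ℕ.* (ι (r ℕ.≟ 0) ℕ.+ ι (r ℕ.≟ 1) ℕ.+ ι (r ℕ.≟ 2))
            ≡⟨ trans (ℕP.*-distribˡ-+ a (ι (r ℕ.≟ 0) ℕ.+ ι (r ℕ.≟ 1)) (ι (r ℕ.≟ 2)))
                     (cong (ℕ._+ a ℕ.* ι (r ℕ.≟ 2)) (ℕP.*-distribˡ-+ a (ι (r ℕ.≟ 0)) (ι (r ℕ.≟ 1)))) ⟩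
          a ℕ.* ι (r ℕ.≟ 0) ℕ.+ a ℕ.* ι (r ℕ.≟ 1) ℕ.+ a ℕ.* ι (r ℕ.≟ 2) ∎

    count-solutions : 2 ℕ.+ R 1# ℕ.+ (W 1 ℕ.+ 2 ℕ.* W 2) ≡ q
    count-solutions = begin
      2 ℕ.+ R 1# ℕ.+ (W 1 ℕ.+ 2 ℕ.* W 2)                      ≡⟨ cong (λ n → n ℕ.+ R 1# ℕ.+ (W 1 ℕ.+ 2 ℕ.* W 2)) R-0 ⟨
      R 0# ℕ.+ R 1# ℕ.+ (W 1 ℕ.+ 2 ℕ.* W 2)                   ≡⟨ cong (R 0# ℕ.+ R 1# ℕ.+_) by-size ⟨
      R 0# ℕ.+ R 1# ℕ.+ ∑ (λ c → ι (off? c) ℕ.* R c)          ≡⟨ ∑-split 0≢1 R ⟨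
      ∑ R                                                     ≡⟨ ∑-fibres-all G ⟩
      q                                                       ∎
      where
      swap : ∀ a b → a ℕ.* (2 ℕ.* b) ≡ 2 ℕ.* (a ℕ.* b)
      swap = solve-∀
      weigh : ∀ a r → r ≤ 2 → a ℕ.* r ≡ a ℕ.* ι (r ℕ.≟ 1) ℕ.+ 2 ℕ.* (a ℕ.* ι (r ℕ.≟ 2))
      weigh a r r≤2 = begin
        a ℕ.* r                                            ≡⟨ cong (a ℕ.*_) (ι-weight r r≤2) ⟨
        a ℕ.* (ι (r ℕ.≟ 1) ℕ.+ 2 ℕ.* ι (r ℕ.≟ 2))          ≡⟨ ℕP.*-distribˡ-+ a _ _ ⟩
        a ℕ.* ι (r ℕ.≟ 1) ℕ.+ a ℕ.* (2 ℕ.* ι (r ℕ.≟ 2))    ≡⟨ cong (a ℕ.* ι (r ℕ.≟ 1) ℕ.+_) (swap a _) ⟩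
        a ℕ.* ι (r ℕ.≟ 1) ℕ.+ 2 ℕ.* (a ℕ.* ι (r ℕ.≟ 2))    ∎
      by-size : ∑ (λ c → ι (off? c) ℕ.* R c) ≡ W 1 ℕ.+ 2 ℕ.* W 2
      by-size = trans (∑-cong (λ c → weigh (ι (off? c)) (R c) (R≤2 c)))
        (trans (∑-+ (λ c → ι (off? c) ℕ.* ι (R c ℕ.≟ 1)) (λ c → 2 ℕ.* (ι (off? c) ℕ.* ι (R c ℕ.≟ 2))))
               (cong (W 1 ℕ.+_) (∑-*ˡ 2 (λ c → ι (off? c) ℕ.* ι (R c ℕ.≟ 2)))))

    -- One-point fibres come from fixed points of τ, of which there is at most one.
    fixed-points : W 1 ℕ.+ ι (R 1# ℕ.≟ 1) ≤ 1
    fixed-points = subst (_≤ 1) (sym singles) (count-≤1 fixed? (λ x y → fixed-unique))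
      where
      singles : W 1 ℕ.+ ι (R 1# ℕ.≟ 1) ≡ count fixed?
      singles = begin
        W 1 ℕ.+ ι (R 1# ℕ.≟ 1)                                  ≡⟨ ℕP.+-comm (W 1) _ ⟩
        ι (R 1# ℕ.≟ 1) ℕ.+ W 1                                  ≡⟨ cong (λ n → ι (n ℕ.≟ 1) ℕ.+ ι (R 1# ℕ.≟ 1) ℕ.+ W 1) R-0 ⟨
        ι (R 0# ℕ.≟ 1) ℕ.+ ι (R 1# ℕ.≟ 1) ℕ.+ W 1              ≡⟨ ∑-split 0≢1 (λ c → ι (R c ℕ.≟ 1)) ⟨
        ∑ (λ c → ι (R c ℕ.≟ 1))                                 ≡⟨ fixed-count ⟩
        count fixed?                                            ∎

    profile : Profile q (occurrences (q ∸ 2))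
    profile = record
      { W               = W
      ; r₁              = R 1#
      ; r₁≤2            = R≤2 1#
      ; W-vanishes      = W-vanishes
      ; fixed-points    = fixed-points
      ; count-values    = count-values
      ; count-solutions = count-solutions
      ; rotation        = rotation
      ; occurrences     = occurrences-formula
      }

  -- For q = 2 the exponent is 0, and N(1, v) = 2 if v = 1 + 1 and 0 otherwise.
  module OrderTwo (q≡2 : q ≡ 2) where

    two : Carrier
    two = 1# + 1#

    N1-at-zero : ∀ v → N1 0 v ≡ ι (v ≟ two) ℕ.* 2
    N1-at-zero v = begin
      N1 0 v                      ≡⟨ N1-line 0 v ⟩
      ∑ (λ _ → ι (two ≟ v))       ≡⟨ ∑-cong (λ _ → ℕP.*-identityʳ (ι (two ≟ v))) ⟨
      ∑ (λ _ → ι (two ≟ v) ℕ.* 1) ≡⟨ ∑-*ˡ (ι (two ≟ v)) (λ _ → 1) ⟩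
      ι (two ≟ v) ℕ.* ∑ (λ _ → 1) ≡⟨ cong₂ ℕ._*_ (ι-cong (two ≟ v) (v ≟ two) sym sym) (trans ∑-ones q≡2) ⟩
      ι (v ≟ two) ℕ.* 2           ∎

    occurrences-at-zero : ∀ k → occurrences (q ∸ 2) k ≡ count (λ v → ι (v ≟ two) ℕ.* 2 ℕ.≟ k)
    occurrences-at-zero k = trans (cong (λ s → occurrences s k) (cong (_∸ 2) q≡2))
      (trans (occurrences-count 0 k) (∑-cong (λ v → cong (λ n → ι (n ℕ.≟ k)) (N1-at-zero v))))

    distribution : occurrences (q ∸ 2) 0 ≡ q / 2 × occurrences (q ∸ 2) 2 ≡ q / 2
    distribution = trans (occurrences-at-zero 0) (trans (count-cong (λ v → ι (v ≟ two) ℕ.* 2 ℕ.≟ 0) (λ v → ¬? (v ≟ two)) zero⇒ ⇒zero) others) ,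
                   trans (occurrences-at-zero 2) (trans (count-cong (λ v → ι (v ≟ two) ℕ.* 2 ℕ.≟ 2) (λ v → v ≟ two) two⇒ ⇒two) (trans (∑-δ two) half))
      where
      half : 1 ≡ q / 2
      half = sym (cong (_/ 2) q≡2)
      others : count (λ v → ¬? (v ≟ two)) ≡ q / 2
      others = trans (ℕP.+-cancelʳ-≡ 1 _ 1 (trans (count-complement two) q≡2)) half
      zero⇒ : ∀ v → ι (v ≟ two) ℕ.* 2 ≡ 0 → v ≢ two
      zero⇒ v N≡0 v≡two = contradiction (trans (sym (cong (ℕ._* 2) (ι-yes (v ≟ two) v≡two))) N≡0) λ ()
      ⇒zero : ∀ v → v ≢ two → ι (v ≟ two) ℕ.* 2 ≡ 0
      ⇒zero v v≢two = cong (ℕ._* 2) (ι-no (v ≟ two) v≢two)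
      two⇒ : ∀ v → ι (v ≟ two) ℕ.* 2 ≡ 2 → v ≡ two
      two⇒ v N≡2 with v ≟ two
      ... | yes v≡two = v≡two
      ... | no _      = contradiction N≡2 λ ()
      ⇒two : ∀ v → v ≡ two → ι (v ≟ two) ℕ.* 2 ≡ 2
      ⇒two v v≡two = cong (ℕ._* 2) (ι-yes (v ≟ two) v≡two)

open import Data.Nat using (_+_)

module Classification (L : FiniteField) where
  open FiniteField L using (order; Nice; occurrences; N1)
  open FieldFacts L using (invertible; value-attained; attained-value; module ExponentQMinusTwo; module OrderTwo)
  open ProfileArithmetic

  q : ℕ
  q = order

  profile : 3 ≤ q → Profile q (occurrences (q ∸ 2))
  profile 3≤q = ExponentQMinusTwo.profile 3≤q

  large : ∀ {r} → q % 6 ≡ 3 + r → 3 ≤ q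
  large e = ℕP.≤-trans (s≤s (s≤s (s≤s z≤n))) (subst (_≤ q) e (m%n≤m q 6))

  distribution-2 : q % 6 ≡ 2 → occurrences (q ∸ 2) 0 ≡ q / 2 × occurrences (q ∸ 2) 2 ≡ q / 2
  distribution-2 e with q ℕ.≟ 2
  ... | yes q≡2 = OrderTwo.distribution q≡2
  ... | no q≢2  = distribution₂ (profile (ℕP.≤∧≢⇒< (subst (_≤ q) e (m%n≤m q 6)) (q≢2 ∘ sym))) e

  nice⇔ : 3 ≤ q → Nice (q ∸ 2) ⇔ (¬ (q % 6 ≡ 1))
  nice⇔ 3≤q = mk⇔ not-nice nice
    where
    nice : ¬ (q % 6 ≡ 1) → Nice (q ∸ 2)
    nice ≢1 = invertible 3≤q , proj₁ listing , proj₁ (proj₂ listing) ,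
              (λ v → proj₂ (proj₂ listing) (N1 (q ∸ 2) v) (value-attained (q ∸ 2) v))
      where
      listing : ∃ λ vals → length vals ≤ 3 × (∀ k → 1 ≤ occurrences (q ∸ 2) k → k ∈ vals)
      listing = three-values (profile 3≤q) ≢1
    not-nice : Nice (q ∸ 2) → ¬ (q % 6 ≡ 1)
    not-nice nice-q-2 e = ℕP.≤⇒≯ short (distinct-members zero-one-two-four zero-one-two-four-injective vals member)
      where
      vals : List ℕ
      vals = proj₁ (proj₂ nice-q-2)
      short : length vals ≤ 3
      short = proj₁ (proj₂ (proj₂ nice-q-2))
      covers : ∀ v → N1 (q ∸ 2) v ∈ vals
      covers = proj₂ (proj₂ (proj₂ nice-q-2))
      listed : ∀ k → 1 ≤ occurrences (q ∸ 2) k → k ∈ vals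
      listed k positive with attained-value (q ∸ 2) k positive
      ... | v , refl = covers v
      occurs : 1 ≤ occurrences (q ∸ 2) 0 × 1 ≤ occurrences (q ∸ 2) 1 × 1 ≤ occurrences (q ∸ 2) 2 × 1 ≤ occurrences (q ∸ 2) 4
      occurs = four-values (profile 3≤q) e
      member : ∀ i → zero-one-two-four i ∈ vals
      member Fin.zero                               = listed 0 (proj₁ occurs)
      member (Fin.suc Fin.zero)                     = listed 1 (proj₁ (proj₂ occurs))
      member (Fin.suc (Fin.suc Fin.zero))           = listed 2 (proj₁ (proj₂ (proj₂ occurs)))
      member (Fin.suc (Fin.suc (Fin.suc Fin.zero))) = listed 4 (proj₂ (proj₂ (proj₂ occurs)))

mainTheorem4 : (L : FiniteField) →
  let q = FiniteField.order L
      s = q ∸ 2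
  in (3 ≤ q → (FiniteField.Nice L s ⇔ (¬ (q % 6 ≡ 1))))
     × (q % 6 ≡ 2 → (FiniteField.occurrences L s 0 ≡ q / 2) × (FiniteField.occurrences L s 2 ≡ q / 2))
     × (q % 6 ≡ 3 → (FiniteField.occurrences L s 0 ≡ (q + 1) / 2) × (FiniteField.occurrences L s 2 ≡ (q ∸ 3) / 2)
                    × (FiniteField.occurrences L s 3 ≡ 1))
     × (q % 6 ≡ 4 → (FiniteField.occurrences L s 0 ≡ q / 2 + 1) × (FiniteField.occurrences L s 2 ≡ q / 2 ∸ 2)
                    × (FiniteField.occurrences L s 4 ≡ 1))
     × (q % 6 ≡ 5 → (FiniteField.occurrences L s 0 ≡ (q ∸ 1) / 2) × (FiniteField.occurrences L s 1 ≡ 1)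
                    × (FiniteField.occurrences L s 2 ≡ (q ∸ 1) / 2))
mainTheorem4 L =
  nice⇔ ,
  distribution-2 ,
  (λ e → distribution₃ (profile (large e)) e) ,
  (λ e → distribution₄ (profile (large e)) e) ,
  (λ e → distribution₅ (profile (large e)) e)
  where
  open Classification L
  open ProfileArithmetic
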